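{- Let $G$ be a simply connected split semisimple group of rank $n$ and $w_0=s_{i_1}\cdots s_{i_K}$ a reduced word. Assign to the vertices the weight triples $\mathrm{w}(x)$ defined in the context. Then for every position $1\le l\le K$, with $j=i_l$, $$\sum_{i\neq j}c_{ij}\,\mathrm{w}(i)+\mathrm{w}(j_-)+\mathrm{w}(j_+)-\epsilon_l\,\mathrm{w}(k^\circ)=(0,0,\alpha_j),$$ where $i$, $j_-$, $j_+$ are the vertices at position $l$, and $\epsilon_l=1$ with $k$ the (unique) node such that $l=t_k$ if such a node exists, and $\epsilon_l=0$ otherwise.
   Context: Simple roots $\alpha_i$, fundamental weights $\omega_i$, Cartan integers $c_{ij}=2(\alpha_i,\alpha_j)/(\alpha_i,\alpha_i)$ (so $\alpha_j=\sum_i c_{ij}\omega_i$). $w_0$ is the longest Weyl group element, $K$ the number of positive roots. $\lambda^*=-w_0\lambda$. For $\lambda=\sum r_i\omega_i$, $\lambda^+=\sum\max(r_i,0)\omega_i$, $\lambda^-=\sum\min(r_i,0)\omega_i$. $u_l=s_{i_1}\cdots s_{i_l}$, $u_0=e$; $t_k$ is the smallest $l$ with $u_l^{ -1}\alpha_k$ negative. Let $a_i=\#\{l:i_l=i\}$, $m_i(l)=\#\{l'\le l:i_{l'}=i\}$. Vertices: $v_{i,0},\dots,v_{i,a_i}$ for each node $i$, and $k^\circ$ for each node $k$. At position $l$ with $i_l=j$: $j_-=v_{j,m_j(l)-1}$, $j_+=v_{j,m_j(l)}$, and for $i\ne j$ the vertex "$i$" is $v_{i,m_i(l)}$. Weights: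 $\mathrm{w}(v_{i,m})=(-w_0(u_l\omega_i)^+,\,-(u_l\omega_i)^-,\,\omega_i)$ for any $l$ with $m_i(l)=m$; $\mathrm{w}(k^\circ)=(\omega_k^*,\omega_k,0)$. (These are the triples $(\lambda,\mu,\nu)$ such that the cluster variable at the vertex on $\mathrm{Conf}_3\mathcal{A}_G$ lies in $[V_\lambda\otimes V_\mu\otimes V_\nu]^G$.) -}

module Defs where

open import Data.Nat using (ℕ; zero; suc; _<_) renaming (_≤_ to _≤ℕ_)
open import Data.Integer using (ℤ; +_; 0ℤ; 1ℤ; _+_; _-_; _*_; -_; _⊔_; _⊓_; _≤_)
open import Data.Fin using (Fin; zero; suc; toℕ)
open import Data.Fin.Properties using (_≟_)
open import Data.List using (List; []; _∷_; foldr; foldl; length; take; lookup)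
open import Data.Product using (Σ; ∃; _×_; _,_)
open import Data.Bool using (if_then_else_)
open import Relation.Nullary using (¬_; does)
open import Relation.Binary.PropositionalEquality using (_≡_; _≢_)

-- A Cartan matrix is C : Fin n → Fin n → ℤ with
-- C i j = c_ij = 2(α_i,α_j)/(α_i,α_i), so α_j = Σ_i c_ij ω_i.
-- Weights are written in the basis of fundamental weights ω_i
-- (G simply connected: weight lattice = ⊕ ℤ ω_i).
-- Roots (for sign tests) are written in the basis of simple roots α_i.

Mat : ℕ → Set
Mat n = Fin n → Fin n → ℤ

Wt : ℕ → Set
Wt n = Fin n → ℤ

sumFin : ∀ {n} → (Fin n → ℤ) → ℤ
sumFin {zero}  f = 0ℤ
sumFin {suc n} f = f zero + sumFin (λ i → f (suc i))

-- Kronecker delta vector (ω_k in weight coordinates, α_k in root coordinates)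
δ : ∀ {n} → Fin n → Fin n → ℤ
δ k m = if does (m ≟ k) then 1ℤ else 0ℤ

-- Cartan matrix of finite type (= Cartan matrix of a split semisimple group):
-- generalized Cartan matrix, symmetrizable by positive d_i, with
-- positive definite symmetrization (d_i c_ij).
record FiniteTypeCartan {n : ℕ} (C : Mat n) : Set where
  field
    diag     : ∀ i → C i i ≡ + 2
    offdiag  : ∀ i j → i ≢ j → C i j ≤ 0ℤ
    zero-sym : ∀ i j → C i j ≡ 0ℤ → C j i ≡ 0ℤ
    d        : Fin n → ℕ
    d-pos    : ∀ i → 0 < d i
    symm     : ∀ i j → + d i * C i j ≡ + d j * C j i
    posdef   : ∀ (x : Fin n → ℤ) → (∃ λ i → x i ≢ 0ℤ) →
               0ℤ Data.Integer.< sumFin (λ i → sumFin (λ j → x i * (+ d i * C i j) * x j))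

-- s_i on weights: s_i λ = λ - ⟨λ,α_i^∨⟩ α_i, ⟨λ,α_i^∨⟩ = λ_i, (α_i)_k = c_ki
reflW : ∀ {n} → Mat n → Fin n → Wt n → Wt n
reflW C i μ k = μ k - μ i * C k i

actW : ∀ {n} → Mat n → List (Fin n) → Wt n → Wt n
actW C ws μ = foldr (reflW C) μ ws

-- s_i on roots in simple-root coordinates:
-- s_i β = β - ⟨β,α_i^∨⟩ α_i, ⟨β,α_i^∨⟩ = Σ_m c_im β_m
reflR : ∀ {n} → Mat n → Fin n → (Fin n → ℤ) → (Fin n → ℤ)
reflR C i β m = if does (m ≟ i) then β i - sumFin (λ m' → C i m' * β m') else β m

-- (s_{i1} ⋯ s_{il})^{-1} β = s_{il} ⋯ s_{i1} β
actRinv : ∀ {n} → Mat n → List (Fin n) → (Fin n → ℤ) → (Fin n → ℤ)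
actRinv C ws β = foldl (λ γ i → reflR C i γ) β ws

NegRoot : ∀ {n} → (Fin n → ℤ) → Set
NegRoot β = (∀ m → β m ≤ 0ℤ) × (∃ λ m → β m ≢ 0ℤ)

SameElt : ∀ {n} → Mat n → List (Fin n) → List (Fin n) → Set
SameElt C w w' = ∀ μ m → actW C w μ m ≡ actW C w' μ m

Reduced : ∀ {n} → Mat n → List (Fin n) → Set
Reduced C w = ∀ w' → SameElt C w' w → length w ≤ℕ length w'

ReducedWordOfLongest : ∀ {n} → Mat n → List (Fin n) → Set
ReducedWordOfLongest C w =
  Reduced C w × (∀ w' → Σ (List _) λ w'' → SameElt C w'' w' × length w'' ≤ℕ length w)

record Tri (n : ℕ) : Set where
  constructor tri
  field
    fst snd thd : Wt n
open Tri public

_+T_ : ∀ {n} → Tri n → Tri n → Tri n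
tri a b c +T tri a' b' c' = tri (λ k → a k + a' k) (λ k → b k + b' k) (λ k → c k + c' k)

_-T_ : ∀ {n} → Tri n → Tri n → Tri n
tri a b c -T tri a' b' c' = tri (λ k → a k - a' k) (λ k → b k - b' k) (λ k → c k - c' k)

_·T_ : ∀ {n} → ℤ → Tri n → Tri n
r ·T tri a b c = tri (λ k → r * a k) (λ k → r * b k) (λ k → r * c k)

zeroT : ∀ {n} → Tri n
zeroT = tri (λ _ → 0ℤ) (λ _ → 0ℤ) (λ _ → 0ℤ)

sumT : ∀ {n m} → (Fin m → Tri n) → Tri n
sumT {m = zero}  f = zeroT
sumT {m = suc m} f = f zero +T sumT (λ i → f (suc i))

_≈T_ : ∀ {n} → Tri n → Tri n → Set
t ≈T t' = ∀ k → (fst t k ≡ fst t' k) × (snd t k ≡ snd t' k) × (thd t k ≡ thd t' k)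

pos neg : ∀ {n} → Wt n → Wt n
pos μ k = μ k ⊔ 0ℤ
neg μ k = μ k ⊓ 0ℤ

-- λ* = -w0 λ, with w0 given by the word w0w
star : ∀ {n} → Mat n → List (Fin n) → Wt n → Wt n
star C w0w μ k = - actW C w0w μ k

-- w(v_{i,m}) computed at a position l with m_i(l) = m, u_l = take l w0w:
-- ( -w0 (u_l ω_i)^+ , -(u_l ω_i)^- , ω_i )
wVert : ∀ {n} → Mat n → List (Fin n) → Fin n → ℕ → Tri n
wVert C w0w i l =
  tri (star C w0w (pos (actW C (take l w0w) (δ i))))
      (λ k → - neg (actW C (take l w0w) (δ i)) k)
      (δ i)

wCirc : ∀ {n} → Mat n → List (Fin n) → Fin n → Tri n
wCirc C w0w k = tri (star C w0w (δ k)) (δ k) (λ _ → 0ℤ)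

-- l = t_k : smallest l with u_l^{-1} α_k negative
IsT : ∀ {n} → Mat n → List (Fin n) → Fin n → ℕ → Set
IsT C w0w k l =
  NegRoot (actRinv C (take l w0w) (δ k)) ×
  (∀ l' → l' < l → ¬ NegRoot (actRinv C (take l' w0w) (δ k)))

-- Left-hand side at position l = p+1 (p : 0-based index), j = i_l:
-- Σ_{i≠j} c_ij w(i) + w(j_-) + w(j_+), where the vertex i = v_{i,m_i(l)} is
-- evaluated with u_l, j_- = v_{j,m_j(l)-1} with u_{l-1}, j_+ = v_{j,m_j(l)} with u_l.
lhsAt : ∀ {n} → Mat n → (w0w : List (Fin n)) → Fin (length w0w) → Tri n
lhsAt C w0w p =
  sumT (λ i → if does (i ≟ j) then zeroT else (C i j ·T wVert C w0w i (suc (toℕ p))))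
  +T (wVert C w0w j (toℕ p) +T wVert C w0w j (suc (toℕ p)))
  where j = lookup w0w p

rhsAt : ∀ {n} → Mat n → Fin n → Tri n
rhsAt C j = tri (λ _ → 0ℤ) (λ _ → 0ℤ) (λ i → C i j)

module Submission where

-- Write j = i_l and u = u_{l-1}, so that u_l = u s_j. The weights entering the left-hand side are
-- u_l ω_i (i ≠ j), u ω_j = u_l s_j ω_j and u_l ω_j, and
--   Σ_{i≠j} c_ij u_l ω_i + u ω_j + u_l ω_j = u_l (α_j - 2ω_j + s_j ω_j + ω_j) = 0.
-- Splitting each weight into positive and negative parts, the first and the second component are
-- therefore both governed by the same combination of negative parts. The m-th coordinate of u_l ω_i
-- has the sign of the i-th coordinate of the root u_l⁻¹ α_m, and every root is positive or negative;
-- so the negative parts either all vanish or all equal the weights, except when u⁻¹ α_m = α_j and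
-- u_l⁻¹ α_m = -α_j, i.e. l = t_m, where their combination is -1. The sign facts about roots come from
-- the exchange argument for reduced words, run with the W-invariant form on the root lattice.

open import Defs
open import Level using (0ℓ)
open import Function using (_∘_)
open import Data.Nat as ℕ using (ℕ; zero; suc; s≤s; z≤n)
import Data.Nat.Properties as ℕP
open import Data.Nat.Induction using (<-rec)
open import Data.Integer as ℤ using (ℤ; +_; +[1+_]; -[1+_]; 0ℤ; 1ℤ; _+_; _-_; _*_; -_; _≤_; _<_; _⊔_; _⊓_; +≤+; +<+; -<+)
import Data.Integer.Properties as ℤP
open import Data.Integer.Tactic.RingSolver using (solve-∀)
open import Data.Fin using (Fin; zero; suc; toℕ; fromℕ<)
open import Data.Fin.Properties using (_≟_; suc-injective; ¬∀⟶∃¬; all?; toℕ-fromℕ<; toℕ<n)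
open import Data.List using (List; []; _∷_; _++_; [_]; foldr; foldl; reverse; length; take; drop; lookup; initLast; _∷ʳ′_)
import Data.List.Properties as List
open import Data.List.Relation.Unary.All using (All; []; _∷_)
open import Data.Bool using (true; false; if_then_else_)
open import Data.Product using (Σ; ∃; _×_; _,_)
open import Data.Sum using (_⊎_; inj₁; inj₂)
open import Data.Empty using (⊥; ⊥-elim)
open import Effect.Monad using (RawMonad)
open import Relation.Nullary using (¬_; Dec; yes; no; does)
open import Relation.Nullary.Negation using (¬¬-Monad)
open import Relation.Nullary.Decidable using (decidable-stable; ¬¬-excluded-middle)
open import Relation.Binary.Definitions using (tri<; tri≈; tri>)
open import Relation.Binary.PropositionalEquality hiding ([_])

ℤ^_ : ℕ → Set
ℤ^ n = Fin n → ℤ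

infixl 6 _⊕_
infixl 7 _·_

_⊕_ : ∀ {n} → ℤ^ n → ℤ^ n → ℤ^ n
(β ⊕ γ) m = β m + γ m

_·_ : ∀ {n} → ℤ → ℤ^ n → ℤ^ n
(a · β) m = a * β m

sumFin-cong : ∀ {n} {f g : ℤ^ n} → f ≗ g → sumFin f ≡ sumFin g
sumFin-cong {zero}  f≗g = refl
sumFin-cong {suc n} f≗g = cong₂ _+_ (f≗g zero) (sumFin-cong (f≗g ∘ suc))

sumFin-⊕ : ∀ {n} (f g : ℤ^ n) → sumFin (f ⊕ g) ≡ sumFin f + sumFin g
sumFin-⊕ {zero}  f g = refl
sumFin-⊕ {suc n} f g =
  trans (cong (λ x → f zero + g zero + x) (sumFin-⊕ (λ i → f (suc i)) (λ i → g (suc i))))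
        (interchange (f zero) (g zero) _ _)
  where
  interchange : ∀ a b c d → a + b + (c + d) ≡ a + c + (b + d)
  interchange = solve-∀

sumFin-· : ∀ {n} a (f : ℤ^ n) → sumFin (a · f) ≡ a * sumFin f
sumFin-· {zero}  a f = sym (ℤP.*-zeroʳ a)
sumFin-· {suc n} a f =
  trans (cong (λ x → a * f zero + x) (sumFin-· a (λ i → f (suc i))))
        (sym (ℤP.*-distribˡ-+ a (f zero) _))

sumFin-zero : ∀ {n} {f : ℤ^ n} → (∀ i → f i ≡ 0ℤ) → sumFin f ≡ 0ℤ
sumFin-zero {zero}  f≡0 = refl
sumFin-zero {suc n} f≡0 = cong₂ _+_ (f≡0 zero) (sumFin-zero (f≡0 ∘ suc))

sumFin-single : ∀ {n} (f : ℤ^ n) k → (∀ i → i ≢ k → f i ≡ 0ℤ) → sumFin f ≡ f k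
sumFin-single f zero    f≡0 =
  trans (cong (_+_ (f zero)) (sumFin-zero (λ i → f≡0 (suc i) λ ()))) (ℤP.+-identityʳ (f zero))
sumFin-single f (suc k) f≡0 =
  trans (cong₂ _+_ (f≡0 zero λ ()) (sumFin-single (f ∘ suc) k (λ i i≢k → f≡0 (suc i) (i≢k ∘ suc-injective))))
        (ℤP.+-identityˡ (f (suc k)))

δ-diag : ∀ {n} (k : Fin n) → δ k k ≡ 1ℤ
δ-diag k with k ≟ k
... | yes _   = refl
... | no k≢k = ⊥-elim (k≢k refl)

δ-off : ∀ {n} {k m : Fin n} → m ≢ k → δ k m ≡ 0ℤ
δ-off {k = k} {m} m≢k with m ≟ k
... | yes m≡k = ⊥-elim (m≢k m≡k)
... | no _    = refl

δ-sym : ∀ {n} (i m : Fin n) → δ i m ≡ δ m i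
δ-sym i m with m ≟ i | i ≟ m
... | yes _   | yes _   = refl
... | no _    | no _    = refl
... | yes m≡i | no i≢m = ⊥-elim (i≢m (sym m≡i))
... | no m≢i | yes i≡m = ⊥-elim (m≢i (sym i≡m))

sumFin-*δ : ∀ {n} (f : ℤ^ n) k → sumFin (λ m → f m * δ k m) ≡ f k
sumFin-*δ f k =
  trans (sumFin-single _ k (λ i i≢k → trans (cong (f i *_) (δ-off i≢k)) (ℤP.*-zeroʳ (f i))))
        (trans (cong (f k *_) (δ-diag k)) (ℤP.*-identityʳ (f k)))

sumFin-δ* : ∀ {n} (f : ℤ^ n) k → sumFin (λ m → δ k m * f m) ≡ f k
sumFin-δ* f k = trans (sumFin-cong (λ m → ℤP.*-comm (δ k m) (f m))) (sumFin-*δ f k)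

supported-at : ∀ {n} (β : ℤ^ n) i → (∀ m → m ≢ i → β m ≡ 0ℤ) → β ≗ β i · δ i
supported-at β i β≡0 m with m ≟ i
... | yes refl = sym (ℤP.*-identityʳ (β m))
... | no m≢i   = trans (β≡0 m m≢i) (sym (ℤP.*-zeroʳ (β i)))

sumFin-pair : ∀ {n} (f : ℤ^ n) {s t} → s ≢ t → (∀ i → i ≢ s → i ≢ t → f i ≡ 0ℤ) →
              sumFin f ≡ f s + f t
sumFin-pair f {s} {t} s≢t f≡0 =
  trans (sumFin-cong split)
        (trans (sumFin-⊕ (λ i → δ s i * f i) (λ i → δ t i * f i)) (cong₂ _+_ (sumFin-δ* f s) (sumFin-δ* f t)))
  where
  split : f ≗ (λ i → δ s i * f i) ⊕ (λ i → δ t i * f i)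
  split i with i ≟ s | i ≟ t
  ... | yes refl | yes refl = ⊥-elim (s≢t refl)
  ... | yes refl | no _     = sym (trans (ℤP.+-identityʳ _) (ℤP.*-identityˡ (f i)))
  ... | no _     | yes refl = sym (trans (ℤP.+-identityˡ _) (ℤP.*-identityˡ (f i)))
  ... | no i≢s   | no i≢t   = f≡0 i i≢s i≢t

sumExcept : ∀ {n} → Fin n → ℤ^ n → ℤ
sumExcept j g = sumFin (λ i → if does (i ≟ j) then 0ℤ else g i)

sumExcept-cong : ∀ {n} (j : Fin n) {g h : ℤ^ n} → (∀ i → i ≢ j → g i ≡ h i) → sumExcept j g ≡ sumExcept j h
sumExcept-cong j {g} {h} g≡h = sumFin-cong pointwise
  where
  pointwise : ∀ i → (if does (i ≟ j) then 0ℤ else g i) ≡ (if does (i ≟ j) then 0ℤ else h i)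
  pointwise i with i ≟ j
  ... | yes _   = refl
  ... | no i≢j = g≡h i i≢j

sumExcept-linear : ∀ {n} (j : Fin n) a b (g h : ℤ^ n) →
                   sumExcept j (a · g ⊕ b · h) ≡ a * sumExcept j g + b * sumExcept j h
sumExcept-linear j a b g h =
  trans (sumFin-cong pointwise) (trans (sumFin-⊕ (a · g') (b · h')) (cong₂ _+_ (sumFin-· a g') (sumFin-· b h')))
  where
  g' h' : ℤ^ _
  g' i = if does (i ≟ j) then 0ℤ else g i
  h' i = if does (i ≟ j) then 0ℤ else h i
  pointwise : ∀ i → (if does (i ≟ j) then 0ℤ else a * g i + b * h i)
                    ≡ a * (if does (i ≟ j) then 0ℤ else g i) + b * (if does (i ≟ j) then 0ℤ else h i)
  pointwise i with does (i ≟ j)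
  ... | true  = sym (cong₂ _+_ (ℤP.*-zeroʳ a) (ℤP.*-zeroʳ b))
  ... | false = refl

sumExcept≡ : ∀ {n} (j : Fin n) (g : ℤ^ n) → sumExcept j g ≡ sumFin g - g j
sumExcept≡ j g = begin
  sumExcept j g                             ≡⟨ sym (ℤP.+-identityʳ _) ⟩
  sumExcept j g + 0ℤ                        ≡⟨ cong (_+_ (sumExcept j g)) (sym (ℤP.+-inverseʳ (g j))) ⟩
  sumExcept j g + (g j - g j)               ≡⟨ sym (ℤP.+-assoc (sumExcept j g) (g j) (- g j)) ⟩
  sumExcept j g + g j - g j                 ≡⟨ cong (λ x → sumExcept j g + x - g j) (sym (sumFin-δ* g j)) ⟩
  sumExcept j g + sumFin (λ i → δ j i * g i) - g j
                                            ≡⟨ cong (_- g j) (sym (sumFin-⊕ {_} _ (λ i → δ j i * g i))) ⟩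
  sumFin (λ i → (if does (i ≟ j) then 0ℤ else g i) + δ j i * g i) - g j
                                            ≡⟨ cong (_- g j) (sumFin-cong reassemble) ⟩
  sumFin g - g j                            ∎
  where
  open ≡-Reasoning
  reassemble : ∀ i → (if does (i ≟ j) then 0ℤ else g i) + δ j i * g i ≡ g i
  reassemble i with i ≟ j
  ... | yes _ = trans (ℤP.+-identityˡ _) (ℤP.*-identityˡ (g i))
  ... | no _  = ℤP.+-identityʳ (g i)

nonNeg*nonNeg : ∀ {i j} → 0ℤ ≤ i → 0ℤ ≤ j → 0ℤ ≤ i * j
nonNeg*nonNeg {+ m} {+ n} _ _ = subst (0ℤ ≤_) (ℤP.pos-* m n) (+≤+ z≤n)

nonNeg*nonPos : ∀ {i j} → 0ℤ ≤ i → j ≤ 0ℤ → i * j ≤ 0ℤ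
nonNeg*nonPos {i} {j} 0≤i j≤0 =
  subst (_≤ 0ℤ) (-[i*-j]≡i*j i j) (ℤP.neg-mono-≤ (nonNeg*nonNeg 0≤i (ℤP.neg-mono-≤ j≤0)))
  where
  -[i*-j]≡i*j : ∀ i j → - (i * - j) ≡ i * j
  -[i*-j]≡i*j = solve-∀

nonPos*nonPos : ∀ {i j} → i ≤ 0ℤ → j ≤ 0ℤ → 0ℤ ≤ i * j
nonPos*nonPos {i} {j} i≤0 j≤0 =
  subst (0ℤ ≤_) (-i*-j≡i*j i j) (nonNeg*nonNeg (ℤP.neg-mono-≤ i≤0) (ℤP.neg-mono-≤ j≤0))
  where
  -i*-j≡i*j : ∀ i j → - i * - j ≡ i * j
  -i*-j≡i*j = solve-∀

pos*neg : ∀ {i j} → 0ℤ < i → j < 0ℤ → i * j < 0ℤ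
pos*neg {+[1+ _ ]} { -[1+ _ ]} _       _         = -<+
pos*neg {+ zero}             (+<+ ())
pos*neg {+[1+ _ ]} {+ _}     _       (+<+ ())

pos*pos : ∀ {i j} → 0ℤ < i → 0ℤ < j → 0ℤ < i * j
pos*pos {+[1+ _ ]} {+[1+ _ ]} _       _         = +<+ (s≤s z≤n)
pos*pos {+ zero}             (+<+ ())
pos*pos {+[1+ _ ]} {+ zero}  _       (+<+ ())

i≢0⇒1≤i*i : ∀ i → i ≢ 0ℤ → 1ℤ ≤ i * i
i≢0⇒1≤i*i (+ zero)  i≢0 = ⊥-elim (i≢0 refl)
i≢0⇒1≤i*i +[1+ _ ]  _   = +≤+ (s≤s z≤n)
i≢0⇒1≤i*i -[1+ _ ]  _   = +≤+ (s≤s z≤n)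

i*j≡1⇒i≡1 : ∀ {i} j → 0ℤ ≤ i → i * j ≡ 1ℤ → i ≡ 1ℤ
i*j≡1⇒i≡1 {+ m} j _ ij≡1 =
  cong +_ (ℕP.m*n≡1⇒m≡1 m ℤ.∣ j ∣ (trans (sym (ℤP.abs-* (+ m) j)) (cong ℤ.∣_∣ ij≡1)))

nonNeg-transfer : ∀ {a b x y} → 0ℤ < a → 0ℤ ≤ b → a * x ≡ b * y → 0ℤ ≤ y → 0ℤ ≤ x
nonNeg-transfer {a} {x = x} 0<a 0≤b ax≡by 0≤y with ℤP.<-cmp x 0ℤ
... | tri< x<0 _ _ = ⊥-elim (ℤP.<⇒≱ (pos*neg 0<a x<0) (subst (0ℤ ≤_) (sym ax≡by) (nonNeg*nonNeg 0≤b 0≤y)))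
... | tri≈ _ refl _ = ℤP.≤-refl
... | tri> _ _ 0<x = ℤP.<⇒≤ 0<x

nonPos-transfer : ∀ {a b x y} → 0ℤ < a → 0ℤ ≤ b → a * x ≡ b * y → y ≤ 0ℤ → x ≤ 0ℤ
nonPos-transfer {a} {b} {x} {y} 0<a 0≤b ax≡by y≤0 =
  subst (_≤ 0ℤ) (ℤP.neg-involutive x)
        (ℤP.neg-mono-≤ (nonNeg-transfer 0<a 0≤b a[-x]≡b[-y] (ℤP.neg-mono-≤ y≤0)))
  where
  a[-x]≡b[-y] : a * - x ≡ b * - y
  a[-x]≡b[-y] = trans (sym (ℤP.neg-distribʳ-* a x)) (trans (cong -_ ax≡by) (ℤP.neg-distribʳ-* b y))

-- Least and greatest elements under double negation. Classical choices are made in the ¬¬ monad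
-- throughout; every final conclusion is a decidable equation, hence ¬¬-stable.

open RawMonad (¬¬-Monad {0ℓ}) using (pure; _>>=_)

Least Greatest : (ℕ → Set) → Set
Least P    = Σ ℕ λ m → P m × (∀ m' → P m' → m ℕ.≤ m')
Greatest P = Σ ℕ λ m → P m × (∀ m' → P m' → m' ℕ.≤ m)

¬¬-least : (P : ℕ → Set) {a : ℕ} → P a → ¬ ¬ Least P
¬¬-least P {a} = <-rec (λ a → P a → ¬ ¬ Least P) step a
  where
  step : ∀ a → (∀ {m} → m ℕ.< a → P m → ¬ ¬ Least P) → P a → ¬ ¬ Least P
  step a smaller pa = ¬¬-excluded-middle {A = Σ ℕ λ m → P m × m ℕ.< a} >>= λ where
    (yes (m , pm , m<a)) → smaller m<a pm
    (no ∄m<a)            → pure (a , pa , λ m' pm' → ℕP.≮⇒≥ λ m'<a → ∄m<a (m' , pm' , m'<a))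

¬¬-greatest : (P : ℕ → Set) (b : ℕ) {a : ℕ} → P a → (∀ m → P m → m ℕ.≤ b) → ¬ ¬ Greatest P
¬¬-greatest P b {a} pa ≤b = go b a pa (λ m pm → ℕP.≤-trans (≤b m pm) (ℕP.m≤n+m b a))
  where
  go : ∀ slack a → P a → (∀ m → P m → m ℕ.≤ a ℕ.+ slack) → ¬ ¬ Greatest P
  go zero        a pa ≤a+0 = pure (a , pa , λ m pm → subst (m ℕ.≤_) (ℕP.+-identityʳ a) (≤a+0 m pm))
  go (suc slack) a pa ≤a+s = ¬¬-excluded-middle {A = Σ ℕ λ m → P m × a ℕ.< m} >>= λ where
    (no ∄m>a)            → pure (a , pa , λ m pm → ℕP.≮⇒≥ λ a<m → ∄m>a (m , pm , a<m))
    (yes (m , pm , a<m)) → go slack m pm λ m' pm' →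
      ℕP.≤-trans (≤a+s m' pm') (subst (ℕ._≤ m ℕ.+ slack) (sym (ℕP.+-suc a slack)) (ℕP.+-monoˡ-≤ slack a<m))

record IsLinear {n} (f : ℤ^ n → ℤ^ n) : Set where
  field
    cong-≗ : ∀ {β γ} → β ≗ γ → f β ≗ f γ
    linear : ∀ a b β γ → f (a · β ⊕ b · γ) ≗ a · f β ⊕ b · f γ

  scale : ∀ a β → f (a · β) ≗ a · f β
  scale a β m =
    trans (cong-≗ (λ k → sym (ℤP.+-identityʳ (a * β k))) m)
          (trans (linear a 0ℤ β β m) (ℤP.+-identityʳ (a * f β m)))

  additive : ∀ β γ → f (β ⊕ γ) ≗ f β ⊕ f γ
  additive β γ m =
    trans (cong-≗ (λ k → sym (cong₂ _+_ (ℤP.*-identityˡ (β k)) (ℤP.*-identityˡ (γ k)))) m)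
          (trans (linear 1ℤ 1ℤ β γ m) (cong₂ _+_ (ℤP.*-identityˡ (f β m)) (ℤP.*-identityˡ (f γ m))))

  zero-vector : f (λ _ → 0ℤ) ≗ λ _ → 0ℤ
  zero-vector m = trans (cong-≗ (λ _ → refl) m) (scale 0ℤ (λ _ → 0ℤ) m)

  sum : ∀ {k} (H : Fin k → ℤ^ n) → f (λ m → sumFin (λ i → H i m)) ≗ λ m → sumFin (λ i → f (H i) m)
  sum {zero}  H = zero-vector
  sum {suc k} H m =
    trans (additive (H zero) (λ m → sumFin (λ i → H (suc i) m)) m)
          (cong (_+_ (f (H zero) m)) (sum (H ∘ suc) m))

  sumExcept-comm : ∀ j (c : ℤ^ n) (H : Fin n → ℤ^ n) →
                   f (λ m → sumExcept j (λ i → c i * H i m)) ≗ λ m → sumExcept j (λ i → c i * f (H i) m)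
  sumExcept-comm j c H m =
    trans (cong-≗ (λ q → sumFin-cong (masked q)) m) (trans (sum H' m) (sumFin-cong f-masked))
    where
    H' : Fin n → ℤ^ n
    H' i = if does (i ≟ j) then (λ _ → 0ℤ) else c i · H i
    masked : ∀ q i → (if does (i ≟ j) then 0ℤ else c i * H i q) ≡ H' i q
    masked q i with does (i ≟ j)
    ... | true  = refl
    ... | false = refl
    f-masked : ∀ i → f (H' i) m ≡ (if does (i ≟ j) then 0ℤ else c i * f (H i) m)
    f-masked i with does (i ≟ j)
    ... | true  = zero-vector m
    ... | false = scale (c i) (H i) m

open IsLinear

∘-isLinear : ∀ {n} {f g : ℤ^ n → ℤ^ n} → IsLinear f → IsLinear g → IsLinear (f ∘ g)
∘-isLinear F G = record
  { cong-≗ = λ β≗γ → cong-≗ F (cong-≗ G β≗γ)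
  ; linear = λ a b β γ m → trans (cong-≗ F (linear G a b β γ) m) (linear F a b _ _ m)
  }

foldr-isLinear : ∀ {n} {A : Set} (r : A → ℤ^ n → ℤ^ n) → (∀ i → IsLinear (r i)) →
                 ∀ w → IsLinear (λ β → foldr r β w)
foldr-isLinear r R []      = record { cong-≗ = λ β≗γ → β≗γ ; linear = λ _ _ _ _ _ → refl }
foldr-isLinear r R (i ∷ w) = ∘-isLinear (R i) (foldr-isLinear r R w)

foldl-isLinear : ∀ {n} {A : Set} (r : A → ℤ^ n → ℤ^ n) → (∀ i → IsLinear (r i)) →
                 ∀ w → IsLinear (λ β → foldl (λ γ i → r i γ) β w)
foldl-isLinear r R []      = record { cong-≗ = λ β≗γ → β≗γ ; linear = λ _ _ _ _ _ → refl }
foldl-isLinear r R (i ∷ w) = ∘-isLinear (foldl-isLinear r R w) (R i)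

module WeylGroup {n : ℕ} (C : Mat n) (FT : FiniteTypeCartan C) where
  open FiniteTypeCartan FT

  ⟨_,α∨_⟩ : ℤ^ n → Fin n → ℤ
  ⟨ β ,α∨ i ⟩ = sumFin (λ m → C i m * β m)

  ⟨,α∨⟩-cong : ∀ {β γ} → β ≗ γ → ∀ i → ⟨ β ,α∨ i ⟩ ≡ ⟨ γ ,α∨ i ⟩
  ⟨,α∨⟩-cong β≗γ i = sumFin-cong (λ m → cong (C i m *_) (β≗γ m))

  ⟨,α∨⟩-linear : ∀ a b β γ i → ⟨ a · β ⊕ b · γ ,α∨ i ⟩ ≡ a * ⟨ β ,α∨ i ⟩ + b * ⟨ γ ,α∨ i ⟩
  ⟨,α∨⟩-linear a b β γ i =
    trans (sumFin-cong (λ m → distrib (C i m) a b (β m) (γ m)))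
          (trans (sumFin-⊕ (a · (λ m → C i m * β m)) (b · (λ m → C i m * γ m)))
                 (cong₂ _+_ (sumFin-· a (λ m → C i m * β m)) (sumFin-· b (λ m → C i m * γ m))))
    where
    distrib : ∀ c a b x y → c * (a * x + b * y) ≡ a * (c * x) + b * (c * y)
    distrib = solve-∀

  ⟨δ,α∨⟩ : ∀ k i → ⟨ δ k ,α∨ i ⟩ ≡ C i k
  ⟨δ,α∨⟩ k i = sumFin-*δ (C i) k

  reflR-formula : ∀ i β m → reflR C i β m ≡ β m - δ i m * ⟨ β ,α∨ i ⟩
  reflR-formula i β m with m ≟ i
  ... | yes refl = cong (_-_ (β m)) (sym (ℤP.*-identityˡ _))
  ... | no _     = sym (ℤP.+-identityʳ (β m))

  reflR-off : ∀ {i m} β → m ≢ i → reflR C i β m ≡ β m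
  reflR-off {i} {m} β m≢i =
    trans (reflR-formula i β m) (trans (cong (λ x → β m - x * ⟨ β ,α∨ i ⟩) (δ-off m≢i)) (ℤP.+-identityʳ (β m)))

  reflR-isLinear : ∀ i → IsLinear (reflR C i)
  reflR-isLinear i = record
    { cong-≗ = λ {β} {γ} β≗γ m →
        trans (reflR-formula i β m)
              (trans (cong₂ (λ x c → x - δ i m * c) (β≗γ m) (⟨,α∨⟩-cong β≗γ i)) (sym (reflR-formula i γ m)))
    ; linear = λ a b β γ m →
        trans (reflR-formula i (a · β ⊕ b · γ) m)
              (trans (cong (λ c → a * β m + b * γ m - δ i m * c) (⟨,α∨⟩-linear a b β γ i))
                     (trans (expand a b (β m) (γ m) (δ i m) ⟨ β ,α∨ i ⟩ ⟨ γ ,α∨ i ⟩)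
                            (sym (cong₂ (λ x y → a * x + b * y) (reflR-formula i β m) (reflR-formula i γ m)))))
    }
    where
    expand : ∀ a b x y e p q → a * x + b * y - e * (a * p + b * q) ≡ a * (x - e * p) + b * (y - e * q)
    expand = solve-∀

  reflW-isLinear : ∀ i → IsLinear (reflW C i)
  reflW-isLinear i = record
    { cong-≗ = λ μ≗ν k → cong₂ (λ x y → x - y * C k i) (μ≗ν k) (μ≗ν i)
    ; linear = λ a b μ ν k → expand a b (μ k) (ν k) (μ i) (ν i) (C k i)
    }
    where
    expand : ∀ a b x y x' y' c → a * x + b * y - (a * x' + b * y') * c ≡ a * (x - x' * c) + b * (y - y' * c)
    expand = solve-∀

  reflR-as-combination : ∀ i β → reflR C i β ≗ 1ℤ · β ⊕ (- ⟨ β ,α∨ i ⟩) · δ i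
  reflR-as-combination i β m =
    trans (reflR-formula i β m) (rearrange (β m) (δ i m) ⟨ β ,α∨ i ⟩)
    where
    rearrange : ∀ x e p → x - e * p ≡ 1ℤ * x + - p * e
    rearrange = solve-∀

  -- β ↦ (⟨β, α_i^∨⟩)_i expresses a root in fundamental-weight coordinates (α_j = Σ_i c_ij ω_i).
  toWeight : ℤ^ n → ℤ^ n
  toWeight β i = ⟨ β ,α∨ i ⟩

  toWeight-reflR : ∀ k β → toWeight (reflR C k β) ≗ reflW C k (toWeight β)
  toWeight-reflR k β m =
    trans (⟨,α∨⟩-cong (reflR-as-combination k β) m)
          (trans (⟨,α∨⟩-linear 1ℤ (- ⟨ β ,α∨ k ⟩) β (δ k) m)
                 (trans (cong (λ c → 1ℤ * ⟨ β ,α∨ m ⟩ + - ⟨ β ,α∨ k ⟩ * c) (⟨δ,α∨⟩ k m))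
                        (rearrange ⟨ β ,α∨ m ⟩ ⟨ β ,α∨ k ⟩ (C m k))))
    where
    rearrange : ∀ x p c → 1ℤ * x + - p * c ≡ x - p * c
    rearrange = solve-∀

  ⟨reflR,α∨⟩ : ∀ i β → ⟨ reflR C i β ,α∨ i ⟩ ≡ - ⟨ β ,α∨ i ⟩
  ⟨reflR,α∨⟩ i β =
    trans (toWeight-reflR i β i)
          (trans (cong (λ c → ⟨ β ,α∨ i ⟩ - ⟨ β ,α∨ i ⟩ * c) (diag i)) (collect ⟨ β ,α∨ i ⟩))
    where
    collect : ∀ p → p - p * + 2 ≡ - p
    collect = solve-∀

  reflR-involutive : ∀ i β → reflR C i (reflR C i β) ≗ β
  reflR-involutive i β m =
    trans (reflR-formula i (reflR C i β) m)
          (trans (cong₂ (λ x c → x - δ i m * c) (reflR-formula i β m) (⟨reflR,α∨⟩ i β))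
                 (cancel (β m) (δ i m) ⟨ β ,α∨ i ⟩))
    where
    cancel : ∀ x e p → x - e * p - e * - p ≡ x
    cancel = solve-∀

  reflW-involutive : ∀ i μ → reflW C i (reflW C i μ) ≗ μ
  reflW-involutive i μ k rewrite diag i = cancel (μ k) (μ i) (C k i)
    where
    cancel : ∀ x y c → x - y * c - (y - y * + 2) * c ≡ x
    cancel = solve-∀

  reflR-simple : ∀ i → reflR C i (δ i) ≗ (- 1ℤ) · δ i
  reflR-simple i m =
    trans (reflR-formula i (δ i) m)
          (trans (cong (λ c → δ i m - δ i m * c) (trans (⟨δ,α∨⟩ i i) (diag i))) (collect (δ i m)))
    where
    collect : ∀ x → x - x * + 2 ≡ - 1ℤ * x
    collect = solve-∀

  actR : List (Fin n) → ℤ^ n → ℤ^ n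
  actR w β = foldr (reflR C) β w

  actR-isLinear : ∀ w → IsLinear (actR w)
  actR-isLinear = foldr-isLinear (reflR C) reflR-isLinear

  actW-isLinear : ∀ w → IsLinear (actW C w)
  actW-isLinear = foldr-isLinear (reflW C) reflW-isLinear

  actRinv-isLinear : ∀ w → IsLinear (actRinv C w)
  actRinv-isLinear = foldl-isLinear (reflR C) reflR-isLinear

  actR-++ : ∀ v x β → actR (v ++ x) β ≡ actR v (actR x β)
  actR-++ v x β = List.foldr-++ (reflR C) β v x

  actW-++ : ∀ v x μ → actW C (v ++ x) μ ≡ actW C v (actW C x μ)
  actW-++ v x μ = List.foldr-++ (reflW C) μ v x

  actRinv-snoc : ∀ u s β → actRinv C (u ++ [ s ]) β ≡ reflR C s (actRinv C u β)
  actRinv-snoc u s β = List.foldl-++ (λ γ i → reflR C i γ) β u [ s ]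

  actR∘actRinv : ∀ w β → actR w (actRinv C w β) ≗ β
  actR∘actRinv []      β m = refl
  actR∘actRinv (i ∷ w) β m =
    trans (cong-≗ (reflR-isLinear i) (actR∘actRinv w (reflR C i β)) m) (reflR-involutive i β m)

  actRinv∘actR : ∀ w β → actRinv C w (actR w β) ≗ β
  actRinv∘actR []      β m = refl
  actRinv∘actR (i ∷ w) β m =
    trans (cong-≗ (actRinv-isLinear w) (reflR-involutive i (actR w β)) m) (actRinv∘actR w β m)

  actRinv≗actR-reverse : ∀ w β → actRinv C w β ≗ actR (reverse w) β
  actRinv≗actR-reverse []      β m = refl
  actRinv≗actR-reverse (i ∷ w) β m =
    trans (actRinv≗actR-reverse w (reflR C i β) m)
          (sym (trans (cong (λ v → actR v β m) (List.unfold-reverse i w))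
                      (cong (λ γ → γ m) (actR-++ (reverse w) [ i ] β))))

  -- The pairing between weights and roots, normalised by (ω_i, α_j) = d_j δ_ij.
  pairing : ℤ^ n → ℤ^ n → ℤ
  pairing μ β = sumFin (λ m → μ m * (+ d m * β m))

  pairing-cong : ∀ {μ μ' β β'} → μ ≗ μ' → β ≗ β' → pairing μ β ≡ pairing μ' β'
  pairing-cong μ≗μ' β≗β' = sumFin-cong (λ m → cong₂ (λ x y → x * (+ d m * y)) (μ≗μ' m) (β≗β' m))

  pairing-δʳ : ∀ μ k → pairing μ (δ k) ≡ + d k * μ k
  pairing-δʳ μ k =
    trans (sumFin-cong (λ m → sym (ℤP.*-assoc (μ m) (+ d m) (δ k m))))
          (trans (sumFin-*δ (λ m → μ m * + d m) k) (ℤP.*-comm (μ k) (+ d k)))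

  pairing-δˡ : ∀ i β → pairing (δ i) β ≡ + d i * β i
  pairing-δˡ i β = sumFin-δ* (λ m → + d m * β m) i

  pairing-reflW : ∀ i μ β → pairing (reflW C i μ) β ≡ pairing μ (reflR C i β)
  pairing-reflW i μ β = trans lhs (sym rhs)
    where
    c : ℤ
    c = ⟨ β ,α∨ i ⟩
    lhs : pairing (reflW C i μ) β ≡ pairing μ β + - (μ i * + d i) * c
    lhs = trans (sumFin-cong (λ m → trans (expand (μ m) (μ i) (C m i) (+ d m) (β m))
                                          (cong (λ x → μ m * (+ d m * β m) + - μ i * (x * β m)) (symm m i))))
                (trans (sumFin-⊕ {n} _ _)
                       (cong (_+_ (pairing μ β))
                             (trans (sumFin-cong (λ m → regroup (μ i) (+ d i) (C i m) (β m)))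
                                    (sumFin-· (- (μ i * + d i)) (λ m → C i m * β m)))))
      where
      expand : ∀ x y c dm b → (x - y * c) * (dm * b) ≡ x * (dm * b) + - y * ((dm * c) * b)
      expand = solve-∀
      regroup : ∀ y di c b → - y * ((di * c) * b) ≡ - (y * di) * (c * b)
      regroup = solve-∀
    rhs : pairing μ (reflR C i β) ≡ pairing μ β + - (μ i * + d i) * c
    rhs = trans (sumFin-cong (λ m → trans (cong (λ x → μ m * (+ d m * x)) (reflR-formula i β m))
                                          (expand (μ m) (+ d m) (β m) (δ i m) c)))
                (trans (sumFin-⊕ {n} _ _)
                       (cong (_+_ (pairing μ β))
                             (trans (sumFin-· (- c) (λ m → μ m * + d m * δ i m))
                                    (trans (cong (- c *_) (sumFin-*δ (λ m → μ m * + d m) i))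
                                           (swap-sign c (μ i * + d i))))))
      where
      expand : ∀ x dm b e c → x * (dm * (b - e * c)) ≡ x * (dm * b) + - c * (x * dm * e)
      expand = solve-∀
      swap-sign : ∀ c y → - c * y ≡ - y * c
      swap-sign = solve-∀

  pairing-actW : ∀ w μ β → pairing (actW C w μ) β ≡ pairing μ (actRinv C w β)
  pairing-actW []      μ β = refl
  pairing-actW (i ∷ w) μ β = trans (pairing-reflW i (actW C w μ) β) (pairing-actW w μ (reflR C i β))

  -- The W-invariant form on the root lattice: (α_i, α_j) = d_i c_ij.
  form : ℤ^ n → ℤ^ n → ℤ
  form β γ = pairing (toWeight β) γ

  form-cong : ∀ {β β' γ γ'} → β ≗ β' → γ ≗ γ' → form β γ ≡ form β' γ'
  form-cong β≗β' γ≗γ' = pairing-cong (⟨,α∨⟩-cong β≗β') γ≗γ'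

  form-reflR : ∀ k β γ → form (reflR C k β) (reflR C k γ) ≡ form β γ
  form-reflR k β γ =
    trans (pairing-cong {β = reflR C k γ} (toWeight-reflR k β) (λ _ → refl))
          (trans (pairing-reflW k (toWeight β) (reflR C k γ))
                 (pairing-cong {μ = toWeight β} (λ _ → refl) (reflR-involutive k γ)))

  form-actR : ∀ w β γ → form (actR w β) (actR w γ) ≡ form β γ
  form-actR []      β γ = refl
  form-actR (i ∷ w) β γ = trans (form-reflR i (actR w β) (actR w γ)) (form-actR w β γ)

  form-actRinv : ∀ w β γ → form (actRinv C w β) (actRinv C w γ) ≡ form β γ
  form-actRinv []      β γ = refl
  form-actRinv (i ∷ w) β γ = trans (form-actRinv w (reflR C i β) (reflR C i γ)) (form-reflR i β γ)

  form-δʳ : ∀ β k → form β (δ k) ≡ + d k * ⟨ β ,α∨ k ⟩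
  form-δʳ β k = pairing-δʳ (toWeight β) k

  form-δδ : ∀ k → form (δ k) (δ k) ≡ + d k * + 2
  form-δδ k = trans (form-δʳ (δ k) k) (cong (+ d k *_) (trans (⟨δ,α∨⟩ k k) (diag k)))

  d-cancelˡ : ∀ m {a b} → + d m * a ≡ + d m * b → a ≡ b
  d-cancelˡ m {a} {b} eq with d m | d-pos m
  ... | suc k | _ = ℤP.*-cancelˡ-≡ (+ suc k) a b eq

  infix 4 _≋_
  record _≋_ (w w' : List (Fin n)) : Set where
    constructor mk≋
    field sameElt : SameElt C w w'
  open _≋_

  ≋-refl : ∀ {w} → w ≋ w
  ≋-refl = mk≋ λ _ _ → refl

  ≋-reflexive : ∀ {w w'} → w ≡ w' → w ≋ w'
  ≋-reflexive refl = ≋-refl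

  ≋-sym : ∀ {w w'} → w ≋ w' → w' ≋ w
  ≋-sym (mk≋ w≡w') = mk≋ λ μ m → sym (w≡w' μ m)

  ≋-trans : ∀ {w w' w''} → w ≋ w' → w' ≋ w'' → w ≋ w''
  ≋-trans (mk≋ w≡w') (mk≋ w'≡w'') = mk≋ λ μ m → trans (w≡w' μ m) (w'≡w'' μ m)

  ++⁺ʳ : ∀ {v v'} x → v ≋ v' → v ++ x ≋ v' ++ x
  ++⁺ʳ {v} {v'} x (mk≋ v≡v') = mk≋ λ μ m →
    trans (cong (λ ν → ν m) (actW-++ v x μ))
          (trans (v≡v' (actW C x μ) m) (cong (λ ν → ν m) (sym (actW-++ v' x μ))))

  ++⁺ˡ : ∀ v {x x'} → x ≋ x' → v ++ x ≋ v ++ x'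
  ++⁺ˡ v {x} {x'} (mk≋ x≡x') = mk≋ λ μ m →
    trans (cong (λ ν → ν m) (actW-++ v x μ))
          (trans (cong-≗ (actW-isLinear v) (x≡x' μ) m) (cong (λ ν → ν m) (sym (actW-++ v x' μ))))

  ss≋ : ∀ s x → s ∷ s ∷ x ≋ x
  ss≋ s x = mk≋ λ μ → reflW-involutive s (actW C x μ)

  snoc-snoc≋ : ∀ w s → (w ++ [ s ]) ++ [ s ] ≋ w
  snoc-snoc≋ w s = ≋-trans (≋-reflexive (List.++-assoc w [ s ] [ s ]))
                           (≋-trans (++⁺ˡ w (ss≋ s [])) (≋-reflexive (List.++-identityʳ w)))

  ≋⇒actRinv≗ : ∀ {w w'} → w ≋ w' → ∀ β → actRinv C w β ≗ actRinv C w' β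
  ≋⇒actRinv≗ {w} {w'} (mk≋ w≡w') β m = d-cancelˡ m (begin
    + d m * actRinv C w β m         ≡⟨ sym (pairing-δˡ m (actRinv C w β)) ⟩
    pairing (δ m) (actRinv C w β)   ≡⟨ sym (pairing-actW w (δ m) β) ⟩
    pairing (actW C w (δ m)) β      ≡⟨ pairing-cong {β = β} (w≡w' (δ m)) (λ _ → refl) ⟩
    pairing (actW C w' (δ m)) β     ≡⟨ pairing-actW w' (δ m) β ⟩
    pairing (δ m) (actRinv C w' β)  ≡⟨ pairing-δˡ m (actRinv C w' β) ⟩
    + d m * actRinv C w' β m        ∎)
    where open ≡-Reasoning

  actRinv≗⇒≋ : ∀ {w w'} → (∀ β → actRinv C w β ≗ actRinv C w' β) → w ≋ w'
  actRinv≗⇒≋ {w} {w'} w≗w' = mk≋ λ μ m → d-cancelˡ m (begin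
    + d m * actW C w μ m             ≡⟨ sym (pairing-δʳ (actW C w μ) m) ⟩
    pairing (actW C w μ) (δ m)       ≡⟨ pairing-actW w μ (δ m) ⟩
    pairing μ (actRinv C w (δ m))    ≡⟨ pairing-cong {μ = μ} (λ _ → refl) (w≗w' (δ m)) ⟩
    pairing μ (actRinv C w' (δ m))   ≡⟨ sym (pairing-actW w' μ (δ m)) ⟩
    pairing (actW C w' μ) (δ m)      ≡⟨ pairing-δʳ (actW C w' μ) m ⟩
    + d m * actW C w' μ m            ∎)
    where open ≡-Reasoning

  ≋⇒actR≗ : ∀ {w w'} → w ≋ w' → ∀ β → actR w β ≗ actR w' β
  ≋⇒actR≗ {w} {w'} w≋w' β m =
    trans (sym (cong-≗ (actR-isLinear w) (λ k → trans (≋⇒actRinv≗ w≋w' (actR w' β) k) (actRinv∘actR w' β k)) m))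
          (actR∘actRinv w (actR w' β) m)

  IsReduced : List (Fin n) → Set
  IsReduced w = ∀ w' → w' ≋ w → length w ℕ.≤ length w'

  Reduced⇒IsReduced : ∀ {w} → Reduced C w → IsReduced w
  Reduced⇒IsReduced reduced w' w'≋w = reduced w' (sameElt w'≋w)

  -- ℓ(w s) ≥ ℓ(w).
  RightAscent : List (Fin n) → Fin n → Set
  RightAscent w s = ∀ z → z ≋ w ++ [ s ] → length w ℕ.≤ length z

  ¬¬-reduced-representative : ∀ w → ¬ ¬ (Σ (List (Fin n)) λ z → z ≋ w × IsReduced z)
  ¬¬-reduced-representative w =
    ¬¬-least Length (w , ≋-refl , refl) >>= λ where
      (_ , (z , z≋w , refl) , least) →
        pure (z , z≋w , λ w' w'≋z → least (length w') (w' , ≋-trans w'≋z z≋w , refl))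
    where
    Length : ℕ → Set
    Length m = Σ (List (Fin n)) λ z → z ≋ w × length z ≡ m

  IsReduced-prefix : ∀ a b → IsReduced (a ++ b) → IsReduced a
  IsReduced-prefix a b red w' w'≋a =
    ℕP.+-cancelʳ-≤ (length b) (length a) (length w')
      (subst₂ ℕ._≤_ (List.length-++ a) (List.length-++ w') (red (w' ++ b) (++⁺ʳ b w'≋a)))

  Nonneg Nonpos : ℤ^ n → Set
  Nonneg γ = ∀ m → 0ℤ ≤ γ m
  Nonpos γ = ∀ m → γ m ≤ 0ℤ

  nonneg? : ∀ γ → Dec (Nonneg γ)
  nonneg? γ = all? (λ m → 0ℤ ℤP.≤? γ m)

  δ-nonneg : ∀ k → Nonneg (δ k)
  δ-nonneg k m with m ≟ k
  ... | yes _ = +≤+ z≤n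
  ... | no _  = +≤+ z≤n

  d-actRinv : ∀ w i j → actRinv C w (δ i) ≗ δ j → + d i ≡ + d j
  d-actRinv w i j w⁻¹αi≗αj = ℤP.*-cancelʳ-≡ (+ d i) (+ d j) (+ 2)
    (trans (sym (form-δδ i))
           (trans (sym (form-actRinv w (δ i) (δ i))) (trans (form-cong w⁻¹αi≗αj w⁻¹αi≗αj) (form-δδ j))))

  weight-root-duality : ∀ w i m → + d m * actW C w (δ i) m ≡ + d i * actRinv C w (δ m) i
  weight-root-duality w i m =
    trans (sym (pairing-δʳ (actW C w (δ i)) m))
          (trans (pairing-actW w (δ i) (δ m)) (pairing-δˡ i (actRinv C w (δ m))))

  conjugate-simple : ∀ u s y → actR u (δ s) ≗ δ y → u ++ [ s ] ≋ y ∷ u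
  conjugate-simple u s y uαs≗αy = actRinv≗⇒≋ λ β m → begin
    actRinv C (u ++ [ s ]) β m                ≡⟨ cong (λ γ → γ m) (actRinv-snoc u s β) ⟩
    reflR C s (φ β) m                         ≡⟨ reflR-as-combination s (φ β) m ⟩
    1ℤ * φ β m + - ⟨ φ β ,α∨ s ⟩ * δ s m
      ≡⟨ cong₂ (λ c e → 1ℤ * φ β m + - c * e) (coroot-transport β) (sym (φαy≗αs m)) ⟩
    1ℤ * φ β m + - ⟨ β ,α∨ y ⟩ * φ (δ y) m
      ≡⟨ sym (linear (actRinv-isLinear u) 1ℤ (- ⟨ β ,α∨ y ⟩) β (δ y) m) ⟩
    φ (1ℤ · β ⊕ (- ⟨ β ,α∨ y ⟩) · δ y) m
      ≡⟨ sym (cong-≗ (actRinv-isLinear u) (reflR-as-combination y β) m) ⟩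
    actRinv C (y ∷ u) β m                     ∎
    where
    open ≡-Reasoning
    φ : ℤ^ n → ℤ^ n
    φ = actRinv C u
    φαy≗αs : φ (δ y) ≗ δ s
    φαy≗αs m = trans (cong-≗ (actRinv-isLinear u) (λ k → sym (uαs≗αy k)) m) (actRinv∘actR u (δ s) m)
    coroot-transport : ∀ β → ⟨ φ β ,α∨ s ⟩ ≡ ⟨ β ,α∨ y ⟩
    coroot-transport β = d-cancelˡ s (begin
      + d s * ⟨ φ β ,α∨ s ⟩   ≡⟨ sym (form-δʳ (φ β) s) ⟩
      form (φ β) (δ s)        ≡⟨ form-cong {β = φ β} (λ _ → refl) (λ k → sym (φαy≗αs k)) ⟩
      form (φ β) (φ (δ y))    ≡⟨ form-actRinv u β (δ y) ⟩
      form β (δ y)            ≡⟨ form-δʳ β y ⟩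
      + d y * ⟨ β ,α∨ y ⟩     ≡⟨ cong (_* ⟨ β ,α∨ y ⟩) (d-actRinv u y s φαy≗αs) ⟩
      + d s * ⟨ β ,α∨ y ⟩     ∎)

  flipped-by-reflection : ∀ w s y → Nonneg (actR w (δ s)) → Nonpos (reflR C y (actR w (δ s))) →
                          actR w (δ s) ≗ δ y
  flipped-by-reflection w s y γ≥0 yγ≤0 = γ≗αy
    where
    open ≡-Reasoning
    γ : ℤ^ n
    γ = actR w (δ s)
    off-y : ∀ k → k ≢ y → γ k ≡ 0ℤ
    off-y k k≢y = ℤP.≤-antisym (subst (_≤ 0ℤ) (reflR-off γ k≢y) (yγ≤0 k)) (γ≥0 k)
    γy≡1 : γ y ≡ 1ℤ
    γy≡1 = i*j≡1⇒i≡1 (actRinv C w (δ y) s) (γ≥0 y) (sym (begin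
      1ℤ                               ≡⟨ sym (δ-diag s) ⟩
      δ s s                            ≡⟨ sym (actRinv∘actR w (δ s) s) ⟩
      actRinv C w γ s                  ≡⟨ cong-≗ (actRinv-isLinear w) (supported-at γ y off-y) s ⟩
      actRinv C w (γ y · δ y) s        ≡⟨ scale (actRinv-isLinear w) (γ y) (δ y) s ⟩
      γ y * actRinv C w (δ y) s        ∎))
    γ≗αy : γ ≗ δ y
    γ≗αy m with m ≟ y
    ... | yes refl = γy≡1
    ... | no m≢y   = off-y m m≢y

  module RankTwo {s t : Fin n} (s≢t : s ≢ t) where

    InST : Fin n → Set
    InST y = y ≡ s ⊎ y ≡ t

    SupportedST : ℤ^ n → Set
    SupportedST γ = ∀ m → m ≢ s → m ≢ t → γ m ≡ 0ℤ

    actR-supported : ∀ x → All InST x → SupportedST (actR x (δ s))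
    actR-supported []      []          m m≢s m≢t = δ-off m≢s
    actR-supported (y ∷ x) (y∈ ∷ x∈) m m≢s m≢t =
      trans (reflR-off (actR x (δ s)) (m≢y y∈)) (actR-supported x x∈ m m≢s m≢t)
      where
      m≢y : InST y → m ≢ y
      m≢y (inj₁ refl) = m≢s
      m≢y (inj₂ refl) = m≢t

    supported-decomposition : ∀ γ → SupportedST γ → γ ≗ γ s · δ s ⊕ γ t · δ t
    supported-decomposition γ γ≡0 m with m ≟ s | m ≟ t
    ... | yes refl | yes refl = ⊥-elim (s≢t refl)
    ... | yes refl | no _     = sym (trans (cong₂ _+_ (ℤP.*-identityʳ (γ m)) (ℤP.*-zeroʳ (γ t))) (ℤP.+-identityʳ (γ m)))
    ... | no _     | yes refl = sym (trans (cong₂ _+_ (ℤP.*-zeroʳ (γ s)) (ℤP.*-identityʳ (γ m))) (ℤP.+-identityˡ (γ m)))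
    ... | no m≢s   | no m≢t   = trans (γ≡0 m m≢s m≢t) (sym (cong₂ _+_ (ℤP.*-zeroʳ (γ s)) (ℤP.*-zeroʳ (γ t))))

    form-supported : ∀ γ → SupportedST γ →
      form γ γ ≡ + d s * + 2 * (γ s * γ s) + + d t * + 2 * (γ t * γ t) + + 2 * (γ s * γ t) * (+ d s * C s t)
    form-supported γ γ≡0 = begin
      form γ γ
        ≡⟨ sumFin-pair _ s≢t (λ m m≢s m≢t → trans (cong (λ x → ⟨ γ ,α∨ m ⟩ * (+ d m * x)) (γ≡0 m m≢s m≢t))
                                                  (trans (cong (⟨ γ ,α∨ m ⟩ *_) (ℤP.*-zeroʳ (+ d m)))
                                                         (ℤP.*-zeroʳ ⟨ γ ,α∨ m ⟩))) ⟩
      ⟨ γ ,α∨ s ⟩ * (+ d s * a) + ⟨ γ ,α∨ t ⟩ * (+ d t * b)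
        ≡⟨ cong₂ (λ x y → x * (+ d s * a) + y * (+ d t * b)) (coroot s) (coroot t) ⟩
      (C s s * a + C s t * b) * (+ d s * a) + (C t s * a + C t t * b) * (+ d t * b)
        ≡⟨ cong₂ (λ x y → (x * a + C s t * b) * (+ d s * a) + (C t s * a + y * b) * (+ d t * b)) (diag s) (diag t) ⟩
      (+ 2 * a + C s t * b) * (+ d s * a) + (C t s * a + + 2 * b) * (+ d t * b)
        ≡⟨ expand (+ d s) (+ d t) (C s t) (C t s) a b ⟩
      + d s * + 2 * (a * a) + + d t * + 2 * (b * b) + (a * b) * (+ d s * C s t) + (a * b) * (+ d t * C t s)
        ≡⟨ cong (λ x → + d s * + 2 * (a * a) + + d t * + 2 * (b * b) + (a * b) * (+ d s * C s t) + (a * b) * x) (symm t s) ⟩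
      + d s * + 2 * (a * a) + + d t * + 2 * (b * b) + (a * b) * (+ d s * C s t) + (a * b) * (+ d s * C s t)
        ≡⟨ double (+ d s * + 2 * (a * a) + + d t * + 2 * (b * b)) (a * b) (+ d s * C s t) ⟩
      + d s * + 2 * (a * a) + + d t * + 2 * (b * b) + + 2 * (a * b) * (+ d s * C s t) ∎
      where
      open ≡-Reasoning
      a b : ℤ
      a = γ s
      b = γ t
      coroot : ∀ i → ⟨ γ ,α∨ i ⟩ ≡ C i s * a + C i t * b
      coroot i = sumFin-pair (λ m → C i m * γ m) s≢t
                   (λ m m≢s m≢t → trans (cong (C i m *_) (γ≡0 m m≢s m≢t)) (ℤP.*-zeroʳ (C i m)))
      expand : ∀ ds dt cst cts a b → (+ 2 * a + cst * b) * (ds * a) + (cts * a + + 2 * b) * (dt * b)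
               ≡ ds * + 2 * (a * a) + dt * + 2 * (b * b) + (a * b) * (ds * cst) + (a * b) * (dt * cts)
      expand = solve-∀
      double : ∀ q p c → q + p * c + p * c ≡ q + + 2 * p * c
      double = solve-∀

    -- With a = γ_s, b = γ_t, the excess (γ,γ) - (α_s,α_s) is 2d_s(a²-1) + 2d_t b² + 2ab d_s c_st,
    -- a sum of non-negative terms, the middle one positive.
    mixed-signs-exceed : ∀ γ → SupportedST γ → γ s * γ t < 0ℤ → + d s * + 2 < form γ γ
    mixed-signs-exceed γ γ≡0 ab<0 =
      subst₂ _<_ (ℤP.+-identityʳ (+ d s * + 2)) (sym form≡)
             (ℤP.+-mono-≤-< (ℤP.≤-refl {+ d s * + 2}) (ℤP.+-mono-<-≤ (ℤP.+-mono-≤-< p₁≥0 p₂>0) p₃≥0))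
      where
      a b : ℤ
      a = γ s
      b = γ t
      p₁ p₂ p₃ : ℤ
      p₁ = + d s * + 2 * (a * a - 1ℤ)
      p₂ = + d t * + 2 * (b * b)
      p₃ = + 2 * (a * b) * (+ d s * C s t)
      form≡ : form γ γ ≡ + d s * + 2 + (p₁ + p₂ + p₃)
      form≡ = trans (form-supported γ γ≡0) (regroup (+ d s) (+ d t) (a * a) (b * b) (a * b) (C s t))
        where
        regroup : ∀ ds dt aa bb ab c → ds * + 2 * aa + dt * + 2 * bb + + 2 * ab * (ds * c)
                  ≡ ds * + 2 + (ds * + 2 * (aa - 1ℤ) + dt * + 2 * bb + + 2 * ab * (ds * c))
        regroup = solve-∀
      nonzero : ∀ {x y} → x * y < 0ℤ → x ≢ 0ℤ
      nonzero xy<0 refl = ℤP.<-irrefl refl xy<0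
      p₁≥0 : 0ℤ ≤ p₁
      p₁≥0 = nonNeg*nonNeg (nonNeg*nonNeg {+ d s} {+ 2} (+≤+ z≤n) (+≤+ z≤n))
                           (ℤP.i≤j⇒0≤j-i (i≢0⇒1≤i*i a (nonzero ab<0)))
      p₂>0 : 0ℤ < p₂
      p₂>0 = pos*pos (pos*pos (+<+ (d-pos t)) (+<+ (s≤s z≤n)))
                     (ℤP.<-≤-trans (+<+ (s≤s z≤n)) (i≢0⇒1≤i*i b (nonzero (subst (_< 0ℤ) (ℤP.*-comm a b) ab<0))))
      p₃≥0 : 0ℤ ≤ p₃
      p₃≥0 = nonPos*nonPos (nonNeg*nonPos {+ 2} (+≤+ z≤n) (ℤP.<⇒≤ ab<0))
                           (nonNeg*nonPos {+ d s} (+≤+ z≤n) (offdiag s t s≢t))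

    -- Mixed signs are ruled out because (x α_s, x α_s) = (α_s, α_s).
    no-mixed-signs : ∀ x → All InST x → ∀ m m' → actR x (δ s) m < 0ℤ → 0ℤ < actR x (δ s) m' → ⊥
    no-mixed-signs x x∈ m m' γm<0 0<γm' = go (m ≟ s) (m ≟ t) (m' ≟ s) (m' ≟ t)
      where
      γ : ℤ^ n
      γ = actR x (δ s)
      mixed : γ s * γ t < 0ℤ → ⊥
      mixed ab<0 = ℤP.<-irrefl (sym (trans (form-actR x (δ s) (δ s)) (form-δδ s)))
                               (mixed-signs-exceed γ (actR-supported x x∈) ab<0)
      zero-off : ∀ k → k ≢ s → k ≢ t → γ k ≡ 0ℤ
      zero-off = actR-supported x x∈
      go : Dec (m ≡ s) → Dec (m ≡ t) → Dec (m' ≡ s) → Dec (m' ≡ t) → ⊥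
      go (no m≢s) (no m≢t) _ _           = ℤP.<-irrefl (zero-off m m≢s m≢t) γm<0
      go _ _ (no m'≢s) (no m'≢t)         = ℤP.<-irrefl (sym (zero-off m' m'≢s m'≢t)) 0<γm'
      go (yes refl) _ (yes refl) _       = ℤP.<-asym γm<0 0<γm'
      go _ (yes refl) _ (yes refl)       = ℤP.<-asym γm<0 0<γm'
      go (yes refl) _ (no _) (yes refl)  = mixed (subst (_< 0ℤ) (ℤP.*-comm (γ t) (γ s)) (pos*neg 0<γm' γm<0))
      go (no _) (yes refl) (yes refl) _  = mixed (pos*neg 0<γm' γm<0)

    rank-two-¬nonneg⇒nonpos : ∀ x → All InST x → ¬ Nonneg (actR x (δ s)) → Nonpos (actR x (δ s))
    rank-two-¬nonneg⇒nonpos x x∈ ¬γ≥0 m' with actR x (δ s) m' ℤP.≤? 0ℤ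
    ... | yes γm'≤0 = γm'≤0
    ... | no γm'≰0 with ¬∀⟶∃¬ n (λ m → 0ℤ ≤ actR x (δ s) m) (λ m → 0ℤ ℤP.≤? actR x (δ s) m) ¬γ≥0
    ...   | m , γm≱0 = ⊥-elim (no-mixed-signs x x∈ m m' (ℤP.≰⇒> γm≱0) (ℤP.≰⇒> γm'≰0))

    -- At the first letter y where the image of α_s turns negative, the rest x maps α_s to α_y,
    -- so x s ≋ y x and the two y's cancel.
    shorten : ∀ x → All InST x → ¬ Nonneg (actR x (δ s)) →
              Σ (List (Fin n)) λ x' → x ++ [ s ] ≋ x' × suc (length x') ≡ length x
    shorten []      _           ¬αs≥0 = ⊥-elim (¬αs≥0 (δ-nonneg s))
    shorten (y ∷ x) (y∈ ∷ x∈) ¬yxαs≥0 with nonneg? (actR x (δ s))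
    ... | yes xαs≥0 = x , ≋-trans (++⁺ˡ [ y ] (conjugate-simple x s y xαs≗αy)) (ss≋ y x) , refl
      where
      xαs≗αy : actR x (δ s) ≗ δ y
      xαs≗αy = flipped-by-reflection x s y xαs≥0 (rank-two-¬nonneg⇒nonpos (y ∷ x) (y∈ ∷ x∈) ¬yxαs≥0)
    ... | no ¬xαs≥0 with shorten x x∈ ¬xαs≥0
    ...   | x' , xs≋x' , 1+|x'|≡|x| = y ∷ x' , ++⁺ˡ [ y ] xs≋x' , cong suc 1+|x'|≡|x|

  -- Write w ≋ v x with x a word in s and t, x as long
  -- as possible; then v is reduced with ascents s and t, x α_s ≥ 0, and w α_s = v (x α_s) ≥ 0.
  module AscentStep (w' : List (Fin n)) (t s : Fin n)
                    (w-red : IsReduced (w' ++ [ t ])) (ascent : RightAscent (w' ++ [ t ]) s)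
                    (IH : ∀ v r → length v ℕ.< length (w' ++ [ t ]) → IsReduced v → RightAscent v r →
                          Nonneg (actR v (δ r))) where

    w : List (Fin n)
    w = w' ++ [ t ]

    |w|≡1+|w'| : length w ≡ suc (length w')
    |w|≡1+|w'| = trans (List.length-++ w') (ℕP.+-comm (length w') 1)

    t≢s : t ≢ s
    t≢s refl = ℕP.<⇒≱ (ℕP.≤-reflexive (sym |w|≡1+|w'|)) (ascent w' (≋-sym (snoc-snoc≋ w' t)))

    open RankTwo {s} {t} (t≢s ∘ sym)

    record Split (ℓ : ℕ) : Set where
      field
        prefix suffix : List (Fin n)
        w≋ : w ≋ prefix ++ suffix
        suffix∈ : All InST suffix
        lengths : length prefix ℕ.+ length suffix ≡ length w
        |suffix| : length suffix ≡ ℓ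

    initial : Split 1
    initial = record { prefix = w' ; suffix = [ t ] ; w≋ = ≋-refl ; suffix∈ = inj₂ refl ∷ []
                     ; lengths = sym (List.length-++ w') ; |suffix| = refl }

    Split-bounded : ∀ ℓ → Split ℓ → ℓ ℕ.≤ length w
    Split-bounded ℓ S = subst (ℕ._≤ length w) |suffix| (subst (length suffix ℕ.≤_) lengths (ℕP.m≤n+m _ _))
      where open Split S

    module Maximal {ℓ} (S : Split ℓ) (maximal : ∀ ℓ' → Split ℓ' → ℓ' ℕ.≤ ℓ) where
      open Split S renaming (prefix to v; suffix to x)

      prefix-reduced : IsReduced v
      prefix-reduced v' v'≋v = ℕP.+-cancelʳ-≤ (length x) (length v) (length v') (begin
        length v ℕ.+ length x  ≡⟨ lengths ⟩
        length w               ≤⟨ w-red (v' ++ x) (≋-trans (++⁺ʳ x v'≋v) (≋-sym w≋)) ⟩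
        length (v' ++ x)       ≡⟨ List.length-++ v' ⟩
        length v' ℕ.+ length x ∎)
        where open ℕP.≤-Reasoning

      prefix-ascent : ∀ r → InST r → RightAscent v r
      prefix-ascent r r∈ z z≋vr with length v ℕP.≤? length z
      ... | yes v≤z = v≤z
      ... | no v≰z = ⊥-elim (ℕP.<-irrefl refl (maximal (suc ℓ) longer))
        where
        w≋zrx : w ≋ z ++ r ∷ x
        w≋zrx = ≋-trans w≋ (≋-trans (++⁺ˡ v (≋-sym (ss≋ r x)))
                          (≋-trans (≋-reflexive (sym (List.++-assoc v [ r ] (r ∷ x)))) (++⁺ʳ (r ∷ x) (≋-sym z≋vr))))
        longer : Split (suc ℓ)
        longer = record
          { prefix = z ; suffix = r ∷ x ; w≋ = w≋zrx ; suffix∈ = r∈ ∷ suffix∈ ; |suffix| = cong suc |suffix|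
          ; lengths = ℕP.≤-antisym
              (subst (ℕ._≤ length w) (sym (ℕP.+-suc (length z) (length x)))
                     (subst (suc (length z) ℕ.+ length x ℕ.≤_) lengths (ℕP.+-monoˡ-≤ (length x) (ℕP.≰⇒> v≰z))))
              (subst (length w ℕ.≤_) (List.length-++ z) (w-red (z ++ r ∷ x) (≋-sym w≋zrx)))
          }

      prefix-shorter : length v ℕ.< length w
      prefix-shorter = subst (length v ℕ.<_) lengths
        (ℕP.m<m+n (length v) (subst (0 ℕ.<_) (sym |suffix|) (maximal 1 initial)))

      suffix-nonneg : Nonneg (actR x (δ s))
      suffix-nonneg with nonneg? (actR x (δ s))
      ... | yes xαs≥0 = xαs≥0
      ... | no ¬xαs≥0 with shorten x suffix∈ ¬xαs≥0
      ...   | x' , xs≋x' , 1+|x'|≡|x| = ⊥-elim (ℕP.<⇒≱ shorter (ascent (v ++ x') (≋-sym ws≋vx')))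
        where
        ws≋vx' : w ++ [ s ] ≋ v ++ x'
        ws≋vx' = ≋-trans (++⁺ʳ [ s ] w≋) (≋-trans (≋-reflexive (List.++-assoc v x [ s ])) (++⁺ˡ v xs≋x'))
        shorter : length (v ++ x') ℕ.< length w
        shorter = subst₂ ℕ._<_ (sym (List.length-++ v))
                         (trans (cong (length v ℕ.+_) 1+|x'|≡|x|) lengths)
                         (ℕP.+-monoʳ-< (length v) (ℕP.n<1+n (length x')))

      nonneg : Nonneg (actR w (δ s))
      nonneg m = subst (0ℤ ≤_) (sym decompose)
        (ℤP.+-mono-≤ (nonNeg*nonNeg (suffix-nonneg s) (vα≥0 s (inj₁ refl) m))
                     (nonNeg*nonNeg (suffix-nonneg t) (vα≥0 t (inj₂ refl) m)))
        where
        γ : ℤ^ n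
        γ = actR x (δ s)
        vα≥0 : ∀ r → InST r → Nonneg (actR v (δ r))
        vα≥0 r r∈ = IH v r prefix-shorter prefix-reduced (prefix-ascent r r∈)
        decompose : actR w (δ s) m ≡ γ s * actR v (δ s) m + γ t * actR v (δ t) m
        decompose = begin
          actR w (δ s) m                   ≡⟨ ≋⇒actR≗ w≋ (δ s) m ⟩
          actR (v ++ x) (δ s) m            ≡⟨ cong (λ β → β m) (actR-++ v x (δ s)) ⟩
          actR v γ m                       ≡⟨ cong-≗ (actR-isLinear v)
                                                      (supported-decomposition γ (actR-supported x suffix∈)) m ⟩
          actR v (γ s · δ s ⊕ γ t · δ t) m ≡⟨ linear (actR-isLinear v) (γ s) (γ t) (δ s) (δ t) m ⟩
          γ s * actR v (δ s) m + γ t * actR v (δ t) m ∎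
          where open ≡-Reasoning

    nonneg : Nonneg (actR w (δ s))
    nonneg = λ m → decidable-stable (0ℤ ℤP.≤? actR w (δ s) m)
      (¬¬-greatest Split (length w) initial Split-bounded >>= λ where
        (ℓ , S , maximal) → pure (Maximal.nonneg S maximal m))

  ascent⇒nonneg : ∀ w s → IsReduced w → RightAscent w s → Nonneg (actR w (δ s))
  ascent⇒nonneg w = bounded (suc (length w)) w ℕP.≤-refl
    where
    bounded : ∀ B w → length w ℕ.< B → ∀ s → IsReduced w → RightAscent w s → Nonneg (actR w (δ s))
    bounded (suc B) w |w|<1+B s w-red ascent with initLast w
    ... | []       = δ-nonneg s
    ... | w' ∷ʳ′ t = AscentStep.nonneg w' t s w-red ascent
                       λ v r |v|<|w| → bounded B v (ℕP.<-≤-trans |v|<|w| (ℕP.≤-pred |w|<1+B)) r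

  reduced-prefix⇒nonneg : ∀ u j → IsReduced (u ++ [ j ]) → Nonneg (actR u (δ j))
  reduced-prefix⇒nonneg u j red = ascent⇒nonneg u j (IsReduced-prefix u [ j ] red)
    λ z z≋uj → ℕP.≤-trans (ℕP.m≤m+n (length u) 1) (subst (ℕ._≤ length z) (List.length-++ u) (red z z≋uj))

  descent⇒nonpos : ∀ z₀ k z → IsReduced z₀ → IsReduced z → z ≋ z₀ ++ [ k ] → length z ℕ.< length z₀ →
                   Nonpos (actR z₀ (δ k))
  descent⇒nonpos z₀ k z z₀-red z-red z≋z₀k |z|<|z₀| m =
    subst (_≤ 0ℤ) (sym z₀αk≡-zαk) (ℤP.neg-mono-≤ (ascent⇒nonneg z k z-red ascent m))
    where
    zk≋z₀ : z ++ [ k ] ≋ z₀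
    zk≋z₀ = ≋-trans (++⁺ʳ [ k ] z≋z₀k) (snoc-snoc≋ z₀ k)
    ascent : RightAscent z k
    ascent y y≋zk = ℕP.<⇒≤ (ℕP.<-≤-trans |z|<|z₀| (z₀-red y (≋-trans y≋zk zk≋z₀)))
    z₀αk≡-zαk : actR z₀ (δ k) m ≡ - actR z (δ k) m
    z₀αk≡-zαk = begin
      actR z₀ (δ k) m               ≡⟨ ≋⇒actR≗ (≋-sym zk≋z₀) (δ k) m ⟩
      actR (z ++ [ k ]) (δ k) m     ≡⟨ cong (λ β → β m) (actR-++ z [ k ] (δ k)) ⟩
      actR z (reflR C k (δ k)) m    ≡⟨ cong-≗ (actR-isLinear z) (reflR-simple k) m ⟩
      actR z ((- 1ℤ) · δ k) m       ≡⟨ scale (actR-isLinear z) (- 1ℤ) (δ k) m ⟩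
      - 1ℤ * actR z (δ k) m         ≡⟨ ℤP.-1*i≡-i (actR z (δ k) m) ⟩
      - actR z (δ k) m              ∎
      where open ≡-Reasoning

  ¬¬-nonneg⊎nonpos-reduced : ∀ z k → IsReduced z → ¬ ¬ (Nonneg (actR z (δ k)) ⊎ Nonpos (actR z (δ k)))
  ¬¬-nonneg⊎nonpos-reduced z k z-red = ¬¬-excluded-middle {A = Shorter} >>= λ where
      (no ∄shorter) → pure (inj₁ (ascent⇒nonneg z k z-red
        λ z' z'≋zk → ℕP.≮⇒≥ λ |z'|<|z| → ∄shorter (z' , z'≋zk , |z'|<|z|)))
      (yes (z' , z'≋zk , |z'|<|z|)) → ¬¬-reduced-representative z' >>= λ where
        (z'' , z''≋z' , z''-red) → pure (inj₂ (descent⇒nonpos z k z'' z-red z''-red (≋-trans z''≋z' z'≋zk)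
                                                 (ℕP.≤-<-trans (z''-red z' (≋-sym z''≋z')) |z'|<|z|)))
    where
    Shorter : Set
    Shorter = Σ (List (Fin n)) λ z' → z' ≋ z ++ [ k ] × length z' ℕ.< length z

  ¬¬-nonneg⊎nonpos : ∀ z k → ¬ ¬ (Nonneg (actR z (δ k)) ⊎ Nonpos (actR z (δ k)))
  ¬¬-nonneg⊎nonpos z k = ¬¬-reduced-representative z >>= λ where
    (z₀ , z₀≋z , z₀-red) → ¬¬-nonneg⊎nonpos-reduced z₀ k z₀-red >>= λ where
      (inj₁ z₀αk≥0) → pure (inj₁ λ m → subst (0ℤ ≤_) (≋⇒actR≗ z₀≋z (δ k) m) (z₀αk≥0 m))
      (inj₂ z₀αk≤0) → pure (inj₂ λ m → subst (_≤ 0ℤ) (≋⇒actR≗ z₀≋z (δ k) m) (z₀αk≤0 m))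

  ¬¬-nonneg⊎nonpos⁻¹ : ∀ w k → ¬ ¬ (Nonneg (actRinv C w (δ k)) ⊎ Nonpos (actRinv C w (δ k)))
  ¬¬-nonneg⊎nonpos⁻¹ w k = ¬¬-nonneg⊎nonpos (reverse w) k >>= λ where
    (inj₁ ≥0) → pure (inj₁ λ m → subst (0ℤ ≤_) (sym (actRinv≗actR-reverse w (δ k) m)) (≥0 m))
    (inj₂ ≤0) → pure (inj₂ λ m → subst (_≤ 0ℤ) (sym (actRinv≗actR-reverse w (δ k) m)) (≤0 m))

  actRinv-nonzero : ∀ w k → ∃ λ m → actRinv C w (δ k) m ≢ 0ℤ
  actRinv-nonzero w k = ¬∀⟶∃¬ n _ (λ m → actRinv C w (δ k) m ℤP.≟ 0ℤ) λ w⁻¹αk≡0 → 1≢0 (begin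
    1ℤ                                ≡⟨ sym (δ-diag k) ⟩
    δ k k                             ≡⟨ sym (actR∘actRinv w (δ k) k) ⟩
    actR w (actRinv C w (δ k)) k      ≡⟨ cong-≗ (actR-isLinear w) w⁻¹αk≡0 k ⟩
    actR w (λ _ → 0ℤ) k               ≡⟨ zero-vector (actR-isLinear w) k ⟩
    0ℤ                                ∎)
    where
    open ≡-Reasoning
    1≢0 : 1ℤ ≢ 0ℤ
    1≢0 ()

  -- A sign change would force w⁻¹ α_k = c α_i with c ≤ 0, whence α_k = c (w α_i) ≤ 0 as w α_i ≥ 0.
  negative-persists : ∀ w i k → IsReduced (w ++ [ i ]) → Nonpos (actRinv C w (δ k)) →
                      ¬ Nonneg (reflR C i (actRinv C w (δ k)))
  negative-persists w i k red η≤0 iη≥0 = ℤP.<⇒≱ (+<+ (s≤s z≤n)) (subst (_≤ 0ℤ) (sym 1≡ηi*wαi) ηi*wαi≤0)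
    where
    open ≡-Reasoning
    η : ℤ^ n
    η = actRinv C w (δ k)
    η≗ηiαi : η ≗ η i · δ i
    η≗ηiαi = supported-at η i λ m m≢i → ℤP.≤-antisym (η≤0 m) (subst (0ℤ ≤_) (reflR-off η m≢i) (iη≥0 m))
    1≡ηi*wαi : 1ℤ ≡ η i * actR w (δ i) k
    1≡ηi*wαi = begin
      1ℤ                         ≡⟨ sym (δ-diag k) ⟩
      δ k k                      ≡⟨ sym (actR∘actRinv w (δ k) k) ⟩
      actR w η k                 ≡⟨ cong-≗ (actR-isLinear w) η≗ηiαi k ⟩
      actR w (η i · δ i) k       ≡⟨ scale (actR-isLinear w) (η i) (δ i) k ⟩
      η i * actR w (δ i) k       ∎
    ηi*wαi≤0 : η i * actR w (δ i) k ≤ 0ℤ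
    ηi*wαi≤0 = subst (_≤ 0ℤ) (ℤP.*-comm (actR w (δ i) k) (η i))
                     (nonNeg*nonPos (reduced-prefix⇒nonneg w i red k) (η≤0 i))

record IsTriProjection {n} (π : Tri n → Wt n) : Set where
  field
    +-hom    : ∀ x y m → π (x +T y) m ≡ π x m + π y m
    ·-hom    : ∀ c x m → π (c ·T x) m ≡ c * π x m
    zero-hom : ∀ m → π zeroT m ≡ 0ℤ

  sumT-hom : ∀ {k} (F : Fin k → Tri n) m → π (sumT F) m ≡ sumFin (λ i → π (F i) m)
  sumT-hom {zero}  F m = zero-hom m
  sumT-hom {suc k} F m = trans (+-hom (F zero) (sumT (F ∘ suc)) m) (cong (_+_ (π (F zero) m)) (sumT-hom (F ∘ suc) m))

fst-isTriProjection : ∀ {n} → IsTriProjection {n} fst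
fst-isTriProjection = record { +-hom = λ _ _ _ → refl ; ·-hom = λ _ _ _ → refl ; zero-hom = λ _ → refl }

snd-isTriProjection : ∀ {n} → IsTriProjection {n} snd
snd-isTriProjection = record { +-hom = λ _ _ _ → refl ; ·-hom = λ _ _ _ → refl ; zero-hom = λ _ → refl }

thd-isTriProjection : ∀ {n} → IsTriProjection {n} thd
thd-isTriProjection = record { +-hom = λ _ _ _ → refl ; ·-hom = λ _ _ _ → refl ; zero-hom = λ _ → refl }

⊔0≡i-⊓0 : ∀ i → i ⊔ 0ℤ ≡ i - i ⊓ 0ℤ
⊔0≡i-⊓0 i with ℤP.≤-total i 0ℤ
... | inj₁ i≤0 = trans (ℤP.i≤j⇒i⊔j≡j i≤0) (sym (trans (cong (_-_ i) (ℤP.i≤j⇒i⊓j≡i i≤0)) (ℤP.+-inverseʳ i)))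
... | inj₂ 0≤i = trans (ℤP.i≥j⇒i⊔j≡i 0≤i) (sym (trans (cong (_-_ i) (ℤP.i≥j⇒i⊓j≡j 0≤i)) (ℤP.+-identityʳ i)))

module Position {n : ℕ} (C : Mat n) (FT : FiniteTypeCartan C) (w₀ : List (Fin n))
                (w₀-red : WeylGroup.IsReduced C FT w₀) (p : Fin (length w₀)) where
  open FiniteTypeCartan FT
  open WeylGroup C FT

  l : ℕ
  l = suc (toℕ p)

  j : Fin n
  j = lookup w₀ p

  exchangeSum : ℤ^ n → ℤ → ℤ → ℤ
  exchangeSum x y z = sumExcept j (λ i → C i j * x i) + (y + z)

  exchangeSum-cong : ∀ {x x' y y' z z'} → (∀ i → i ≢ j → x i ≡ x' i) → y ≡ y' → z ≡ z' →
                     exchangeSum x y z ≡ exchangeSum x' y' z'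
  exchangeSum-cong x≡x' y≡y' z≡z' =
    cong₂ _+_ (sumExcept-cong j λ i i≢j → cong (C i j *_) (x≡x' i i≢j)) (cong₂ _+_ y≡y' z≡z')

  exchangeSum-linear : ∀ a b x y z x' y' z' →
    exchangeSum (a · x ⊕ b · x') (a * y + b * y') (a * z + b * z') ≡ a * exchangeSum x y z + b * exchangeSum x' y' z'
  exchangeSum-linear a b x y z x' y' z' =
    trans (cong (_+ (a * y + b * y' + (a * z + b * z')))
                (trans (sumExcept-cong j (λ i _ → distrib (C i j) a b (x i) (x' i)))
                       (sumExcept-linear j a b (λ i → C i j * x i) (λ i → C i j * x' i))))
          (regroup a b (sumExcept j (λ i → C i j * x i)) (sumExcept j (λ i → C i j * x' i)) y y' z z')
    where
    distrib : ∀ c a b x x' → c * (a * x + b * x') ≡ a * (c * x) + b * (c * x')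
    distrib = solve-∀
    regroup : ∀ a b s s' y y' z z' → a * s + b * s' + (a * y + b * y' + (a * z + b * z'))
              ≡ a * (s + (y + z)) + b * (s' + (y' + z'))
    regroup = solve-∀

  exchangeSum-neg : ∀ x y z → exchangeSum (λ i → - x i) (- y) (- z) ≡ - exchangeSum x y z
  exchangeSum-neg x y z =
    trans (exchangeSum-cong (λ i _ → as-combination (x i)) (as-combination y) (as-combination z))
          (trans (exchangeSum-linear (- 1ℤ) 0ℤ x y z x y z) (collapse (exchangeSum x y z)))
    where
    as-combination : ∀ v → - v ≡ - 1ℤ * v + 0ℤ * v
    as-combination = solve-∀
    collapse : ∀ e → - 1ℤ * e + 0ℤ * e ≡ - e
    collapse = solve-∀

  exchangeSum-⊖ : ∀ x y z x' y' z' →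
    exchangeSum (λ i → x i - x' i) (y - y') (z - z') ≡ exchangeSum x y z - exchangeSum x' y' z'
  exchangeSum-⊖ x y z x' y' z' =
    trans (exchangeSum-cong (λ i _ → as-combination (x i) (x' i)) (as-combination y y') (as-combination z z'))
          (trans (exchangeSum-linear 1ℤ (- 1ℤ) x y z x' y' z') (collapse (exchangeSum x y z) (exchangeSum x' y' z')))
    where
    as-combination : ∀ v v' → v - v' ≡ 1ℤ * v + - 1ℤ * v'
    as-combination = solve-∀
    collapse : ∀ e e' → 1ℤ * e + - 1ℤ * e' ≡ e - e'
    collapse = solve-∀

  exchangeSum-comm : ∀ {f} → IsLinear f → ∀ (X : Fin n → ℤ^ n) Y Z m →
    f (λ q → exchangeSum (λ i → X i q) (Y q) (Z q)) m ≡ exchangeSum (λ i → f (X i) m) (f Y m) (f Z m)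
  exchangeSum-comm F X Y Z m =
    trans (additive F (λ q → sumExcept j (λ i → C i j * X i q)) (Y ⊕ Z) m)
          (cong₂ _+_ (sumExcept-comm F j (λ i → C i j) X m) (additive F Y Z m))

  cartan-column : ∀ q → exchangeSum (λ i → δ i q) (δ j q) (δ j q) ≡ C q j
  cartan-column q = begin
    sumExcept j (λ i → C i j * δ i q) + (δ j q + δ j q)
      ≡⟨ cong (_+ (δ j q + δ j q)) (sumExcept≡ j (λ i → C i j * δ i q)) ⟩
    sumFin (λ i → C i j * δ i q) - C j j * δ j q + (δ j q + δ j q)
      ≡⟨ cong₂ (λ s c → s - c * δ j q + (δ j q + δ j q))
               (trans (sumFin-cong (λ i → cong (C i j *_) (δ-sym i q))) (sumFin-*δ (λ i → C i j) q)) (diag j) ⟩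
    C q j - + 2 * δ j q + (δ j q + δ j q)
      ≡⟨ cancel (C q j) (δ j q) ⟩
    C q j ∎
    where
    open ≡-Reasoning
    cancel : ∀ c e → c - + 2 * e + (e + e) ≡ c
    cancel = solve-∀

  vertex : ℕ → Fin n → ℤ^ n
  vertex r i = actW C (take r w₀) (δ i)

  combine : (ℤ^ n → ℤ^ n) → ℤ^ n
  combine F m = exchangeSum (λ i → F (vertex l i) m) (F (vertex (toℕ p) j) m) (F (vertex l j) m)

  lhs-projection : ∀ {π} → IsTriProjection π → ∀ m →
    π (lhsAt C w₀ p) m
      ≡ exchangeSum (λ i → π (wVert C w₀ i l) m) (π (wVert C w₀ j (toℕ p)) m) (π (wVert C w₀ j l) m)
  lhs-projection {π} Π m =
    trans (+-hom (sumT summand) _ m)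
          (cong₂ _+_ (trans (sumT-hom summand m) (sumFin-cong masked)) (+-hom (wVert C w₀ j (toℕ p)) _ m))
    where
    open IsTriProjection Π
    summand : Fin n → Tri n
    summand i = if does (i ≟ j) then zeroT else (C i j ·T wVert C w₀ i l)
    masked : ∀ i → π (summand i) m ≡ (if does (i ≟ j) then 0ℤ else C i j * π (wVert C w₀ i l) m)
    masked i with does (i ≟ j)
    ... | true  = zero-hom m
    ... | false = ·-hom (C i j) (wVert C w₀ i l) m

  u U : List (Fin n)
  u = take (toℕ p) w₀
  U = take l w₀

  U≡uj : U ≡ u ++ [ j ]
  U≡uj = List.take-suc w₀ p

  exchange-relation : ∀ m → combine (λ μ → μ) m ≡ 0ℤ
  exchange-relation m = begin
    exchangeSum (λ i → V (δ i) m) (actW C u (δ j) m) (V (δ j) m)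
      ≡⟨ exchangeSum-cong (λ _ _ → refl) uωj≡Usjωj refl ⟩
    exchangeSum (λ i → V (δ i) m) (V (reflW C j (δ j)) m) (V (δ j) m)
      ≡⟨ sym (exchangeSum-comm (actW-isLinear U) δ (reflW C j (δ j)) (δ j) m) ⟩
    V (λ q → exchangeSum (λ i → δ i q) (reflW C j (δ j) q) (δ j q)) m
      ≡⟨ cong-≗ (actW-isLinear U) vanishes m ⟩
    V (λ _ → 0ℤ) m
      ≡⟨ zero-vector (actW-isLinear U) m ⟩
    0ℤ ∎
    where
    open ≡-Reasoning
    V : ℤ^ n → ℤ^ n
    V = actW C U
    uωj≡Usjωj : actW C u (δ j) m ≡ V (reflW C j (δ j)) m
    uωj≡Usjωj = begin
      actW C u (δ j) m                         ≡⟨ sym (cong-≗ (actW-isLinear u) (reflW-involutive j (δ j)) m) ⟩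
      actW C u (reflW C j (reflW C j (δ j))) m ≡⟨ cong (λ ν → ν m) (sym (actW-++ u [ j ] (reflW C j (δ j)))) ⟩
      actW C (u ++ [ j ]) (reflW C j (δ j)) m  ≡⟨ cong (λ w → actW C w (reflW C j (δ j)) m) (sym U≡uj) ⟩
      V (reflW C j (δ j)) m                    ∎
    vanishes : ∀ q → exchangeSum (λ i → δ i q) (reflW C j (δ j) q) (δ j q) ≡ 0ℤ
    vanishes q =
      trans (rearrange (sumExcept j (λ i → C i j * δ i q)) (δ j q) (δ j j) (C q j))
            (trans (cong (λ x → x - δ j j * C q j) (cartan-column q))
                   (trans (cong (λ e → C q j - e * C q j) (δ-diag j)) (cancel (C q j))))
      where
      rearrange : ∀ s e e' c → s + (e - e' * c + e) ≡ s + (e + e) - e' * c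
      rearrange = solve-∀
      cancel : ∀ c → c - 1ℤ * c ≡ 0ℤ
      cancel = solve-∀

  combine-pos : ∀ m → combine pos m ≡ - combine neg m
  combine-pos m = begin
    combine pos m
      ≡⟨ exchangeSum-cong (λ i _ → ⊔0≡i-⊓0 (vertex l i m)) (⊔0≡i-⊓0 (vertex (toℕ p) j m))
                          (⊔0≡i-⊓0 (vertex l j m)) ⟩
    exchangeSum (λ i → vertex l i m - neg (vertex l i) m) (vertex (toℕ p) j m - neg (vertex (toℕ p) j) m)
                (vertex l j m - neg (vertex l j) m)
      ≡⟨ exchangeSum-⊖ (λ i → vertex l i m) (vertex (toℕ p) j m) (vertex l j m)
                       (λ i → neg (vertex l i) m) (neg (vertex (toℕ p) j) m) (neg (vertex l j) m) ⟩
    combine (λ μ → μ) m - combine neg m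
      ≡⟨ cong (_- combine neg m) (exchange-relation m) ⟩
    0ℤ - combine neg m
      ≡⟨ ℤP.+-identityˡ (- combine neg m) ⟩
    - combine neg m ∎
    where open ≡-Reasoning

  lhs-thd : ∀ m → thd (lhsAt C w₀ p) m ≡ C m j
  lhs-thd m = trans (lhs-projection thd-isTriProjection m) (cartan-column m)

  lhs-snd : ∀ m → snd (lhsAt C w₀ p) m ≡ - combine neg m
  lhs-snd m = trans (lhs-projection snd-isTriProjection m)
                    (exchangeSum-neg (λ i → neg (vertex l i) m) (neg (vertex (toℕ p) j) m) (neg (vertex l j) m))

  lhs-fst : ∀ m → fst (lhsAt C w₀ p) m ≡ - actW C w₀ (combine pos) m
  lhs-fst m =
    trans (lhs-projection fst-isTriProjection m)
          (trans (exchangeSum-neg (λ i → actW C w₀ (pos (vertex l i)) m) (actW C w₀ (pos (vertex (toℕ p) j)) m)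
                                  (actW C w₀ (pos (vertex l j)) m))
                 (cong -_ (sym (exchangeSum-comm (actW-isLinear w₀) (λ i → pos (vertex l i))
                                                 (pos (vertex (toℕ p) j)) (pos (vertex l j)) m))))

  exchangeSum-zero : ∀ y z → exchangeSum (λ _ → 0ℤ) y z ≡ y + z
  exchangeSum-zero y z = trans (cong (_+ (y + z)) (sumFin-zero masked)) (ℤP.+-identityˡ (y + z))
    where
    masked : ∀ i → (if does (i ≟ j) then 0ℤ else C i j * 0ℤ) ≡ 0ℤ
    masked i with does (i ≟ j)
    ... | true  = refl
    ... | false = ℤP.*-zeroʳ (C i j)

  prefix-reduced : ∀ r → IsReduced (take r w₀)
  prefix-reduced r =
    IsReduced-prefix (take r w₀) (drop r w₀) (subst IsReduced (sym (List.take++drop≡id r w₀)) w₀-red)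

  take-snoc : ∀ r (r<|w₀| : r ℕ.< length w₀) → take (suc r) w₀ ≡ take r w₀ ++ [ lookup w₀ (fromℕ< r<|w₀|) ]
  take-snoc r r<|w₀| =
    subst (λ k → take (suc k) w₀ ≡ take k w₀ ++ [ lookup w₀ (fromℕ< r<|w₀|) ]) (toℕ-fromℕ< r<|w₀|)
          (List.take-suc w₀ (fromℕ< r<|w₀|))

  ¬¬-nonpos-persists : ∀ k r m → r ℕ.+ k ℕ.≤ length w₀ → Nonpos (actRinv C (take r w₀) (δ m)) →
                       ¬ ¬ Nonpos (actRinv C (take (r ℕ.+ k) w₀) (δ m))
  ¬¬-nonpos-persists zero    r m _ ≤0 =
    pure (subst (λ r' → Nonpos (actRinv C (take r' w₀) (δ m))) (sym (ℕP.+-identityʳ r)) ≤0)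
  ¬¬-nonpos-persists (suc k) r m r+k<|w₀| ≤0 =
    ¬¬-nonneg⊎nonpos⁻¹ (take (suc r) w₀) m >>= λ where
      (inj₁ ≥0) → ⊥-elim (negative-persists (take r w₀) y m (subst IsReduced snoc (prefix-reduced (suc r))) ≤0
                          λ q → subst (0ℤ ≤_) (trans (cong (λ w → actRinv C w (δ m) q) snoc)
                                                     (cong (λ β → β q) (actRinv-snoc (take r w₀) y (δ m)))) (≥0 q))
      (inj₂ ≤0') → subst (λ r' → ¬ ¬ Nonpos (actRinv C (take r' w₀) (δ m))) (sym (ℕP.+-suc r k))
                         (¬¬-nonpos-persists k (suc r) m (subst (ℕ._≤ length w₀) (ℕP.+-suc r k) r+k<|w₀|) ≤0')
    where
    r<|w₀| : r ℕ.< length w₀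
    r<|w₀| = ℕP.<-≤-trans (ℕP.m<m+n r (s≤s z≤n)) r+k<|w₀|
    y : Fin n
    y = lookup w₀ (fromℕ< r<|w₀|)
    snoc : take (suc r) w₀ ≡ take r w₀ ++ [ y ]
    snoc = take-snoc r r<|w₀|

  γ γ' : Fin n → ℤ^ n
  γ m = actRinv C u (δ m)
  γ' m = actRinv C U (δ m)

  γ'≗sjγ : ∀ m → γ' m ≗ reflR C j (γ m)
  γ'≗sjγ m q = trans (cong (λ w → actRinv C w (δ m) q) U≡uj) (cong (λ β → β q) (actRinv-snoc u j (δ m)))

  -- l = t_m exactly when u_{l-1}⁻¹ α_m = α_j.
  Flip : Fin n → Set
  Flip m = γ m ≗ δ j

  flip? : ∀ m → Dec (Flip m)
  flip? m = all? (λ q → γ m q ℤP.≟ δ j q)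

  flip-injective : ∀ {m m'} → Flip m → Flip m' → m ≡ m'
  flip-injective {m} {m'} flip flip' with m ≟ m'
  ... | yes m≡m' = m≡m'
  ... | no m≢m'  = ⊥-elim (1≢0 (begin
    1ℤ                     ≡⟨ sym (δ-diag m) ⟩
    δ m m                  ≡⟨ sym (actR∘actRinv u (δ m) m) ⟩
    actR u (γ m) m         ≡⟨ cong-≗ (actR-isLinear u) (λ q → trans (flip q) (sym (flip' q))) m ⟩
    actR u (γ m') m        ≡⟨ actR∘actRinv u (δ m') m ⟩
    δ m' m                 ≡⟨ δ-off m≢m' ⟩
    0ℤ                     ∎))
    where
    open ≡-Reasoning
    1≢0 : 1ℤ ≢ 0ℤ
    1≢0 ()

  sign-change⇒flip : ∀ m → Nonneg (γ m) → Nonpos (γ' m) → Flip m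
  sign-change⇒flip m γ≥0 γ'≤0 q =
    trans (actRinv≗actR-reverse u (δ m) q)
          (flipped-by-reflection (reverse u) m j
            (λ q' → subst (0ℤ ≤_) (actRinv≗actR-reverse u (δ m) q') (γ≥0 q'))
            (λ q' → subst (_≤ 0ℤ) (trans (γ'≗sjγ m q') (cong-≗ (reflR-isLinear j) (actRinv≗actR-reverse u (δ m)) q'))
                          (γ'≤0 q'))
            q)

  flip⇒γ'≗-αj : ∀ m → Flip m → γ' m ≗ (- 1ℤ) · δ j
  flip⇒γ'≗-αj m flip q = trans (γ'≗sjγ m q) (trans (cong-≗ (reflR-isLinear j) flip q) (reflR-simple j q))

  vertex-duality : ∀ r i m → + d m * vertex r i m ≡ + d i * actRinv C (take r w₀) (δ m) i
  vertex-duality r = weight-root-duality (take r w₀)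

  flip-value : ∀ m → Flip m → combine neg m ≡ - 1ℤ
  flip-value m flip =
    trans (exchangeSum-cong (λ i i≢j → cong (_⊓ 0ℤ) (off-j i i≢j)) (cong (_⊓ 0ℤ) before) (cong (_⊓ 0ℤ) after))
          (exchangeSum-zero 0ℤ (- 1ℤ))
    where
    dm≡dj : + d m ≡ + d j
    dm≡dj = d-actRinv u m j flip
    γ'≗-αj : γ' m ≗ (- 1ℤ) · δ j
    γ'≗-αj = flip⇒γ'≗-αj m flip
    off-j : ∀ i → i ≢ j → vertex l i m ≡ 0ℤ
    off-j i i≢j = d-cancelˡ m
      (trans (vertex-duality l i m)
             (trans (cong (+ d i *_) (trans (γ'≗-αj i) (cong (- 1ℤ *_) (δ-off i≢j))))
                    (trans (ℤP.*-zeroʳ (+ d i)) (sym (ℤP.*-zeroʳ (+ d m))))))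
    before : vertex (toℕ p) j m ≡ 1ℤ
    before = d-cancelˡ m
      (trans (vertex-duality (toℕ p) j m) (trans (cong (+ d j *_) (trans (flip j) (δ-diag j))) (cong (_* 1ℤ) (sym dm≡dj))))
    after : vertex l j m ≡ - 1ℤ
    after = d-cancelˡ m
      (trans (vertex-duality l j m)
             (trans (cong (+ d j *_) (trans (γ'≗-αj j) (cong (- 1ℤ *_) (δ-diag j)))) (cong (_* - 1ℤ) (sym dm≡dj))))

  no-flip-value : ∀ m → ¬ Flip m → combine neg m ≡ 0ℤ
  no-flip-value m ¬flip = decidable-stable (combine neg m ℤP.≟ 0ℤ)
    (¬¬-nonneg⊎nonpos⁻¹ u m >>= λ γ-sign → ¬¬-nonneg⊎nonpos⁻¹ U m >>= λ γ'-sign → pure (by-signs γ-sign γ'-sign))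
    where
    nonneg-at : ∀ r i → 0ℤ ≤ actRinv C (take r w₀) (δ m) i → neg (vertex r i) m ≡ 0ℤ
    nonneg-at r i ≥0 = ℤP.i≥j⇒i⊓j≡j (nonNeg-transfer {b = + d i} (+<+ (d-pos m)) (+≤+ z≤n) (vertex-duality r i m) ≥0)
    nonpos-at : ∀ r i → actRinv C (take r w₀) (δ m) i ≤ 0ℤ → neg (vertex r i) m ≡ vertex r i m
    nonpos-at r i ≤0 = ℤP.i≤j⇒i⊓j≡i (nonPos-transfer {b = + d i} (+<+ (d-pos m)) (+≤+ z≤n) (vertex-duality r i m) ≤0)
    by-signs : Nonneg (γ m) ⊎ Nonpos (γ m) → Nonneg (γ' m) ⊎ Nonpos (γ' m) → combine neg m ≡ 0ℤ
    by-signs (inj₁ γ≥0) (inj₁ γ'≥0) =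
      trans (exchangeSum-cong (λ i _ → nonneg-at l i (γ'≥0 i)) (nonneg-at (toℕ p) j (γ≥0 j)) (nonneg-at l j (γ'≥0 j)))
            (exchangeSum-zero 0ℤ 0ℤ)
    by-signs (inj₂ γ≤0) (inj₂ γ'≤0) =
      trans (exchangeSum-cong (λ i _ → nonpos-at l i (γ'≤0 i)) (nonpos-at (toℕ p) j (γ≤0 j)) (nonpos-at l j (γ'≤0 j)))
            (exchange-relation m)
    by-signs (inj₂ γ≤0) (inj₁ γ'≥0) = ⊥-elim
      (negative-persists u j m (subst IsReduced U≡uj (prefix-reduced l)) γ≤0
                         (λ q → subst (0ℤ ≤_) (γ'≗sjγ m q) (γ'≥0 q)))
    by-signs (inj₁ γ≥0) (inj₂ γ'≤0) = ⊥-elim (¬flip (sign-change⇒flip m γ≥0 γ'≤0))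

  Flip⇒IsT : ∀ m → Flip m → IsT C w₀ m l
  Flip⇒IsT m flip = (γ'≤0 , j , γ'j≢0) , earlier
    where
    γ'≤0 : Nonpos (γ' m)
    γ'≤0 q = subst (_≤ 0ℤ) (sym (trans (flip⇒γ'≗-αj m flip q) (ℤP.-1*i≡-i (δ j q))))
                   (ℤP.neg-mono-≤ (δ-nonneg j q))
    γ'j≢0 : γ' m j ≢ 0ℤ
    γ'j≢0 γ'j≡0 with trans (sym (γ'j≡0)) (trans (flip⇒γ'≗-αj m flip j) (cong (- 1ℤ *_) (δ-diag j)))
    ... | ()
    earlier : ∀ l' → l' ℕ.< l → ¬ NegRoot (actRinv C (take l' w₀) (δ m))
    earlier l' (s≤s l'≤p) (≤0 , _) =
      ¬¬-nonpos-persists (toℕ p ℕ.∸ l') l' m (subst (ℕ._≤ length w₀) (sym l'+[p-l']≡p) (ℕP.<⇒≤ (toℕ<n p))) ≤0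
        λ ≤0' → ℤP.<⇒≱ (+<+ (s≤s z≤n))
                   (subst (_≤ 0ℤ) (trans (cong (λ r → actRinv C (take r w₀) (δ m) j) l'+[p-l']≡p)
                                         (trans (flip j) (δ-diag j)))
                          (≤0' j))
      where
      l'+[p-l']≡p : l' ℕ.+ (toℕ p ℕ.∸ l') ≡ toℕ p
      l'+[p-l']≡p = ℕP.m+[n∸m]≡n l'≤p

  IsT⇒Flip : ∀ m → IsT C w₀ m l → Flip m
  IsT⇒Flip m ((γ'≤0 , _) , earliest) = decidable-stable (flip? m) (¬¬-nonneg⊎nonpos⁻¹ u m >>= λ where
    (inj₁ γ≥0) → pure (sign-change⇒flip m γ≥0 γ'≤0)
    (inj₂ γ≤0) → ⊥-elim (earliest (toℕ p) (ℕP.n<1+n (toℕ p)) (γ≤0 , actRinv-nonzero u m)))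

  relation-at-t : ∀ k → IsT C w₀ k l → (lhsAt C w₀ p -T wCirc C w₀ k) ≈T rhsAt C j
  relation-at-t k isT m = fst-eq , snd-eq , trans (ℤP.+-identityʳ _) (lhs-thd m)
    where
    flip-k : Flip k
    flip-k = IsT⇒Flip k isT
    neg-values : ∀ q → combine neg q ≡ - δ k q
    neg-values q with q ≟ k
    ... | yes refl = flip-value q flip-k
    ... | no q≢k   = no-flip-value q (λ flip-q → q≢k (flip-injective flip-q flip-k))
    pos-values : ∀ q → combine pos q ≡ δ k q
    pos-values q = trans (combine-pos q) (trans (cong -_ (neg-values q)) (ℤP.neg-involutive (δ k q)))
    fst-eq : fst (lhsAt C w₀ p) m - star C w₀ (δ k) m ≡ 0ℤ
    fst-eq = trans (cong (_- star C w₀ (δ k) m) (trans (lhs-fst m) (cong -_ (cong-≗ (actW-isLinear w₀) pos-values m))))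
                   (ℤP.+-inverseʳ (star C w₀ (δ k) m))
    snd-eq : snd (lhsAt C w₀ p) m - δ k m ≡ 0ℤ
    snd-eq = trans (cong (_- δ k m) (trans (lhs-snd m) (trans (cong -_ (neg-values m)) (ℤP.neg-involutive (δ k m)))))
                   (ℤP.+-inverseʳ (δ k m))

  relation-off-t : (∀ k → ¬ IsT C w₀ k l) → lhsAt C w₀ p ≈T rhsAt C j
  relation-off-t ¬t m = fst-eq , trans (lhs-snd m) (cong -_ (neg-zero m)) , lhs-thd m
    where
    neg-zero : ∀ q → combine neg q ≡ 0ℤ
    neg-zero q = no-flip-value q (¬t q ∘ Flip⇒IsT q)
    fst-eq : fst (lhsAt C w₀ p) m ≡ 0ℤ
    fst-eq = trans (lhs-fst m)
      (cong -_ (trans (cong-≗ (actW-isLinear w₀) (λ q → trans (combine-pos q) (cong -_ (neg-zero q))) m)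
                      (zero-vector (actW-isLinear w₀) m)))

proposition4p2 : (n : ℕ) (C : Mat n) → FiniteTypeCartan C →
    (w0w : List (Fin n)) → ReducedWordOfLongest C w0w →
    (p : Fin (length w0w)) →
    ((k : Fin n) → IsT C w0w k (suc (toℕ p)) →
    (lhsAt C w0w p -T wCirc C w0w k) ≈T rhsAt C (lookup w0w p))
    × (((k : Fin n) → ¬ IsT C w0w k (suc (toℕ p))) →
    lhsAt C w0w p ≈T rhsAt C (lookup w0w p))
proposition4p2 n C FT w0w (reduced , _) p = relation-at-t , relation-off-t
  where open Position C FT w0w (WeylGroup.Reduced⇒IsReduced C FT reduced) p
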